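{- Let $m$ be a positive integer, $l$ a non-negative integer, $q=2^m$, and $\delta\in\mathbb{F}_{q^3}$. Put $A=\mathrm{Tr}_m^{3m}(\delta^{2+q}+\delta^{2+q^2})$, $B=\mathrm{Tr}_m^{3m}(\delta^2+\delta^{1+q})$ and $D=\delta^{q^2+q+1}\mathrm{Tr}_m^{3m}(\delta)$. Assume that $$f(x)=\left(\mathrm{Tr}_m^{3m}(x)+\delta\right)^{q^2+q+2}+\mathrm{Tr}_m^{3m}(x)^{2^l}+x^{2^l}$$ permutes $\mathbb{F}_{q^3}$. Then: (1) If $A=0$ and $B=0$, the compositional inverse of $f$ over $\mathbb{F}_{q^3}$ is $$f^{ -1}(x)=x^{q^3/2^l}+\left((\mathrm{Tr}_m^{3m}(x)+D)^{q/4}+\delta\right)^{(q^2+q+2)q^3/2^l}+(\mathrm{Tr}_m^{3m}(x)+D)^{q/4}.$$ (2) If $B=0$ and $A\neq0$ is not a cube of an element of $\mathbb{F}_q$, then, with $d=\gcd(m,2)$ and $N=N_{2^m/2^d}(A)=A^{(2^m-1)/(2^d-1)}$, and $L(x)=\frac{N}{1+N}\sum_{i=0}^{m/d-1}A^{ -\frac{4^{i+1}-1}{3}}\left(\mathrm{Tr}_m^{3m}(x)+D\right)^{4^i}$, the compositional inverse of $f$ over $\mathbb{F}_{q^3}$ is $$f^{ -1}(x)=\left(\delta+L(x)\right)^{(q^2+q+2)q^3/2^l}+x^{q^3/2^l}+L(x).$$ (3) If $AB\neq0$, let $(S_i)_{i\ge -1}$ be the sequence with $S_{ -1}=0$, $S_0=1$,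 $S_i=B^{2^{i-1}}S_{i-1}+A^{2^{i-1}}S_{i-2}$ for $i\ge1$, and let $M(x)=\sum_{i=0}^{m-1}\left(S_{m-2-i}^{2^{i+1}}+A^{1-2^{i+1}}S_i\right)\left(\mathrm{Tr}_m^{3m}(x)+D\right)^{2^i}$. Then the compositional inverse of $f$ over $\mathbb{F}_{q^3}$ is $$f^{ -1}(x)=\left(\delta+M(x)\right)^{(q^2+q+2)q^3/2^l}+x^{q^3/2^l}+M(x).$$
   Context: $\mathrm{Tr}_m^{3m}(x)=x+x^{q}+x^{q^2}$ is the trace map from $\mathbb{F}_{q^3}$ to $\mathbb{F}_q$. For $d\mid m$, $N_{2^m/2^d}$ denotes the norm map from $\mathbb{F}_{2^m}$ to $\mathbb{F}_{2^d}$, $N_{2^m/2^d}(a)=a^{(2^m-1)/(2^d-1)}$. Exponents written as fractions such as $q^3/2^l$ and $q/4$ denote the corresponding powers of $2$ (e.g. $q^3/2^l=2^{3m-l}$). The compositional inverse of a permutation polynomial $F$ of $\mathbb{F}_{q^3}$ is the unique polynomial map $F^{ -1}$ with $F(F^{ -1}(x))=F^{ -1}(F(x))=x$ for all $x\in\mathbb{F}_{q^3}$. -}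

module Defs where

open import Level using (0ℓ)
open import Data.Nat as ℕ using (ℕ; zero; suc; _∸_; NonZero; ≢-nonZero)
open import Data.Nat.DivMod using (_/_)
open import Data.Nat.GCD using (gcd; gcd[m,n]≢0)
open import Data.Fin using (Fin)
open import Data.Sum using (inj₂)
open import Data.Product using (∃; _×_)
open import Relation.Binary.PropositionalEquality using (_≡_; _≢_)
open import Relation.Nullary using (¬_)
open import Algebra.Structures using (IsCommutativeRing)
open import Function.Bundles using (_↔_)

-- A finite field with exactly 2^(3m) elements, i.e. (a model of) F_{q^3}, q = 2^m.
-- Equality is propositional equality.
record GF-q³ (m : ℕ) : Set₁ where
  infixl 6 _+_
  infixl 7 _*_
  field
    Carrier : Set
    _+_ _*_ : Carrier → Carrier → Carrier
    -_ : Carrier → Carrier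
    0# 1# : Carrier
    _⁻¹ : Carrier → Carrier
    isCommutativeRing : IsCommutativeRing _≡_ _+_ _*_ -_ 0# 1#
    0≢1 : 0# ≢ 1#
    inverseʳ : ∀ x → x ≢ 0# → x * (x ⁻¹) ≡ 1#
    card : Carrier ↔ Fin (2 ℕ.^ (3 ℕ.* m))

module Setup {m : ℕ} (F : GF-q³ m) (l : ℕ) (δ : GF-q³.Carrier F) where
  open GF-q³ F

  infixr 8 _^_
  _^_ : Carrier → ℕ → Carrier
  x ^ zero = 1#
  x ^ suc n = x * (x ^ n)

  Σ< : ℕ → (ℕ → Carrier) → Carrier
  Σ< zero g = 0#
  Σ< (suc n) g = Σ< n g + g n

  q : ℕ
  q = 2 ℕ.^ m

  Tr : Carrier → Carrier
  Tr x = x + x ^ q + x ^ (q ℕ.* q)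

  InFq : Carrier → Set
  InFq y = y ^ q ≡ y

  IsCubeInFq : Carrier → Set
  IsCubeInFq a = ∃ λ y → InFq y × (y * y * y ≡ a)

  -- x ↦ x^{q^3/2^l}: the inverse of the Frobenius power x ↦ x^{2^l},
  -- realised as the power 2^(3ml - l) (note x^(2^(3ml)) = x on F_{q^3}).
  root2^l : ℕ
  root2^l = 2 ℕ.^ (3 ℕ.* m ℕ.* l ∸ l)

  -- y ↦ y^{q/4} for y ∈ F_q, realised as the power 2^(4m-2) (= 2^(m-2) on F_q).
  qOver4 : ℕ
  qOver4 = 2 ℕ.^ (4 ℕ.* m ∸ 2)

  A B D : Carrier
  A = Tr (δ ^ (2 ℕ.+ q) + δ ^ (2 ℕ.+ q ℕ.* q))
  B = Tr (δ ^ 2 + δ ^ (1 ℕ.+ q))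
  D = δ ^ (q ℕ.* q ℕ.+ q ℕ.+ 1) * Tr δ

  e : ℕ
  e = q ℕ.* q ℕ.+ q ℕ.+ 2

  f : Carrier → Carrier
  f x = (Tr x + δ) ^ e + Tr x ^ (2 ℕ.^ l) + x ^ (2 ℕ.^ l)

  finv₁ : Carrier → Carrier
  finv₁ x = x ^ root2^l + (((Tr x + D) ^ qOver4 + δ) ^ e) ^ root2^l + (Tr x + D) ^ qOver4

  d : ℕ
  d = gcd m 2

  instance
    d-nonZero : NonZero d
    d-nonZero = ≢-nonZero (gcd[m,n]≢0 m 2 (inj₂ λ ()))

  2^d-1-nonZero : NonZero (2 ℕ.^ d ∸ 1)
  2^d-1-nonZero = helper d
    where
    helper : (k : ℕ) → .{{NonZero k}} → NonZero (2 ℕ.^ k ∸ 1)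
    helper (suc k) = ≢-nonZero (lem k)
      where
      open import Data.Nat.Properties using (m^n>0; m+1+n≢0)
      lem : ∀ k → 2 ℕ.* (2 ℕ.^ k) ∸ 1 ≢ 0
      lem k eq with 2 ℕ.^ k | m^n>0 2 k
      ... | suc t | _ = go t eq
        where
        go : ∀ t → suc (t ℕ.+ suc (t ℕ.+ 0)) ∸ 1 ≢ 0
        go t = m+1+n≢0 t

  Nrm : Carrier
  Nrm = A ^ (_/_ (2 ℕ.^ m ∸ 1) (2 ℕ.^ d ∸ 1) {{2^d-1-nonZero}})

  L : Carrier → Carrier
  L x = (Nrm * ((1# + Nrm) ⁻¹)) *
        Σ< (m / d) (λ i → (A ⁻¹) ^ ((4 ℕ.^ (suc i) ∸ 1) / 3) * (Tr x + D) ^ (4 ℕ.^ i))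

  finv₂ : Carrier → Carrier
  finv₂ x = ((δ + L x) ^ e) ^ root2^l + x ^ root2^l + L x

  -- case (3): Sh k = S_{k-1}, so Sh 0 = S_{-1} = 0, Sh 1 = S_0 = 1,
  -- Sh (k+2) = S_{k+1} = B^{2^k} S_k + A^{2^k} S_{k-1}
  Sh : ℕ → Carrier
  Sh zero = 0#
  Sh (suc zero) = 1#
  Sh (suc (suc k)) = B ^ (2 ℕ.^ k) * Sh (suc k) + A ^ (2 ℕ.^ k) * Sh k

  S : ℕ → Carrier
  S i = Sh (suc i)

  -- M(x) = Σ_{i=0}^{m-1} (S_{m-2-i}^{2^{i+1}} + A^{1-2^{i+1}} S_i) (Tr x + D)^{2^i};
  -- S_{m-2-i} = Sh (m-1-i) (for i ≤ m-1, so i = m-1 gives S_{-1} = 0)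
  M : Carrier → Carrier
  M x = Σ< m (λ i → (Sh (m ∸ 1 ∸ i) ^ (2 ℕ.^ suc i) + (A ⁻¹) ^ (2 ℕ.^ suc i ∸ 1) * S i)
                    * (Tr x + D) ^ (2 ℕ.^ i))

  finv₃ : Carrier → Carrier
  finv₃ x = ((δ + M x) ^ e) ^ root2^l + x ^ root2^l + M x

  IsCompInverse : (Carrier → Carrier) → Set
  IsCompInverse g = (∀ x → f (g x) ≡ x) × (∀ x → g (f x) ≡ x)

{-# OPTIONS --safe #-}
module Submission where

-- For T = Tr x ∈ F_q one has Tr (f x) + D = Λ T, where Λ T = T ^ 4 + B T ^ 2 + A T, and
-- x ^ 2 ^ l = f x + T ^ 2 ^ l + (T + δ) ^ e. So if R inverts Λ on F_q, the map
-- y ↦ ((δ + R (Tr y + D)) ^ e) ^ (q³/2ˡ) + y ^ (q³/2ˡ) + R (Tr y + D) is a left inverse of the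
-- bijection f. The three cases supply R: T ↦ T ^ (q/4) when A = B = 0; a telescoping sum
-- when B = 0 (then m is even, as for odd m every nonzero element of F_q is a cube); and in
-- general the recurrence Λ T ^ 2 ^ j = T ^ 2 ^ (j + 2) + B ^ 2 ^ j T ^ 2 ^ (j + 1) + A ^ 2 ^ j T ^ 2 ^ j,
-- unrolled over j < m with 2 × 2 companion matrices, which gives M (Λ T) = Δ T for
-- Δ = det (I + K_{m-1} ⋯ K_0) ∈ F_2. Since f is onto, so is Λ on F_q, and the degenerate
-- constants (1 + N = 0, Δ = 0) are excluded because the maps u ↦ u ^ 2 ^ i (i < m) are
-- linearly independent over F_q.

open import Defs
open import Level using (0ℓ)
open import Data.Nat as ℕ using (ℕ; zero; suc; NonZero)
import Data.Nat.Properties as ℕP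
open import Data.Nat.DivMod using (m*n/n≡m)
open import Data.Nat.GCD using (gcd; c*gcd[m,n]≡gcd[cm,cn]; gcd-zeroʳ)
open import Data.Nat.Logarithm using (⌊log₂_⌋; ⌊log₂[2^n]⌋≡n)
open import Data.Nat.Solver using (module +-*-Solver)
open import Data.Fin as Fin using (Fin; punchIn)
open import Data.Fin.Properties using (¬Fin0; punchInᵢ≢i; inj⇒≟)
open import Function.Properties.Inverse using (↔⇒↣)
open import Data.Fin.Permutation using (Permutation; permutation)
open import Data.Product using (_×_; _,_; proj₁; proj₂; ∃)
open import Data.Sum using (_⊎_; inj₁; inj₂)
open import Data.List as List using (List; []; _∷_; length)
open import Data.List.Properties using (length-map; length-tabulate)
open import Data.List.Relation.Unary.All as All using (All; []; _∷_)
open import Data.List.Relation.Unary.AllPairs using (AllPairs; []; _∷_)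
open import Data.List.Relation.Unary.Unique.Propositional.Properties using (tabulate⁺)
open import Data.Empty using (⊥; ⊥-elim)
open import Relation.Nullary using (¬_; yes; no)
open import Relation.Binary.Definitions using (DecidableEquality)
open import Relation.Binary.PropositionalEquality
open import Function using (_∘_; Inverse; _↔_)
open import Function.Definitions using (Bijective; Surjective)
open import Algebra.Bundles using (CommutativeSemiring; CommutativeMonoid; Ring)
open import Algebra.Structures using (IsCommutativeRing)
import Algebra.Properties.Ring
import Algebra.Properties.CommutativeMonoid.Sum

geom₄ : ℕ → ℕ
geom₄ zero = 0
geom₄ (suc n) = 4 ℕ.^ n ℕ.+ geom₄ n

4^n≡1+geom₄*3 : ∀ n → 4 ℕ.^ n ≡ suc (geom₄ n ℕ.* 3)
4^n≡1+geom₄*3 zero = refl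
4^n≡1+geom₄*3 (suc n) = begin
  4 ℕ.* 4 ℕ.^ n                        ≡⟨ cong (4 ℕ.*_) (4^n≡1+geom₄*3 n) ⟩
  4 ℕ.* suc (g ℕ.* 3)                  ≡⟨ solve 1 (λ g → con 4 :* (con 1 :+ g :* con 3)
                                                 := con 1 :+ ((con 1 :+ g :* con 3) :+ g) :* con 3) refl g ⟩
  suc ((suc (g ℕ.* 3) ℕ.+ g) ℕ.* 3)    ≡⟨ cong (λ w → suc ((w ℕ.+ g) ℕ.* 3)) (sym (4^n≡1+geom₄*3 n)) ⟩
  suc ((4 ℕ.^ n ℕ.+ g) ℕ.* 3)          ∎
  where
  open ≡-Reasoning
  open +-*-Solver
  g : ℕ
  g = geom₄ n

[4^n∸1]/3≡geom₄ : ∀ n → (4 ℕ.^ n ℕ.∸ 1) ℕ./ 3 ≡ geom₄ n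
[4^n∸1]/3≡geom₄ n = trans (cong (λ w → (w ℕ.∸ 1) ℕ./ 3) (4^n≡1+geom₄*3 n)) (m*n/n≡m (geom₄ n) 3)

4^n≡2^[2*n] : ∀ n → 4 ℕ.^ n ≡ 2 ℕ.^ (2 ℕ.* n)
4^n≡2^[2*n] = ℕP.^-*-assoc 2 2

gcd[2*k,2]≡2 : ∀ k → gcd (2 ℕ.* k) 2 ≡ 2
gcd[2*k,2]≡2 k = trans (sym (c*gcd[m,n]≡gcd[cm,cn] 2 k 1)) (cong (2 ℕ.*_) (gcd-zeroʳ k))

2^-injective : ∀ {a b} → 2 ℕ.^ a ≡ 2 ℕ.^ b → a ≡ b
2^-injective {a} {b} eq =
  trans (sym (⌊log₂[2^n]⌋≡n a)) (trans (cong ⌊log₂_⌋ eq) (⌊log₂[2^n]⌋≡n b))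

even⊎odd : ∀ n → (∃ λ k → n ≡ 2 ℕ.* k) ⊎ (∃ λ k → n ≡ suc (2 ℕ.* k))
even⊎odd zero = inj₁ (0 , refl)
even⊎odd (suc n) with even⊎odd n
... | inj₁ (k , refl) = inj₂ (k , refl)
... | inj₂ (k , refl) = inj₁ (suc k , cong suc (sym (ℕP.+-suc k (k ℕ.+ 0))))

n<m⇒m∸n≡1+[m∸1+n] : ∀ {m n} → n ℕ.< m → m ℕ.∸ n ≡ suc (m ℕ.∸ suc n)
n<m⇒m∸n≡1+[m∸1+n] {suc m} {zero} _ = refl
n<m⇒m∸n≡1+[m∸1+n] {suc m} {suc n} (ℕ.s≤s n<m) = n<m⇒m∸n≡1+[m∸1+n] n<m

-- Setup's _^_ and Σ< are (nominally) indexed by l and δ, so every module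
-- below is stated under the same parameters as Setup.
module Field {m' : ℕ} (F : GF-q³ (suc m')) (l : ℕ) (δ : GF-q³.Carrier F) where
  open GF-q³ F
  open Setup F l δ using (_^_; Σ<)
  open IsCommutativeRing isCommutativeRing hiding (refl; sym; trans)
  open ≡-Reasoning

  commutativeSemiring : CommutativeSemiring 0ℓ 0ℓ
  commutativeSemiring = record { isCommutativeSemiring = isCommutativeSemiring }

  open import Algebra.Solver.Ring.NaturalCoefficients.Default commutativeSemiring

  ^-identityʳ : ∀ x → x ^ 1 ≡ x
  ^-identityʳ = *-identityʳ

  ^-distribˡ-+-* : ∀ x a b → x ^ (a ℕ.+ b) ≡ x ^ a * x ^ b
  ^-distribˡ-+-* x zero b = sym (*-identityˡ _)
  ^-distribˡ-+-* x (suc a) b = trans (cong (x *_) (^-distribˡ-+-* x a b)) (sym (*-assoc _ _ _))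

  ^-distribʳ-* : ∀ x y n → (x * y) ^ n ≡ x ^ n * y ^ n
  ^-distribʳ-* x y zero = sym (*-identityˡ _)
  ^-distribʳ-* x y (suc n) = trans (cong ((x * y) *_) (^-distribʳ-* x y n))
    (solve 4 (λ x y a b → (x :* y) :* (a :* b) := (x :* a) :* (y :* b)) refl x y (x ^ n) (y ^ n))

  ^-*-assocʳ : ∀ x a b → x ^ (a ℕ.* b) ≡ (x ^ b) ^ a
  ^-*-assocʳ x zero b = refl
  ^-*-assocʳ x (suc a) b = trans (^-distribˡ-+-* x b (a ℕ.* b)) (cong (x ^ b *_) (^-*-assocʳ x a b))

  ^-*-assoc : ∀ x a b → (x ^ a) ^ b ≡ x ^ (a ℕ.* b)
  ^-*-assoc x a b = trans (sym (^-*-assocʳ x b a)) (cong (x ^_) (ℕP.*-comm b a))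

  ^-^-comm : ∀ x a b → (x ^ a) ^ b ≡ (x ^ b) ^ a
  ^-^-comm x a b = trans (^-*-assoc x a b) (^-*-assocʳ x a b)

  ^-^-2^ : ∀ x a b → (x ^ (2 ℕ.^ a)) ^ (2 ℕ.^ b) ≡ x ^ (2 ℕ.^ (a ℕ.+ b))
  ^-^-2^ x a b = trans (^-*-assoc x (2 ℕ.^ a) (2 ℕ.^ b)) (cong (x ^_) (sym (ℕP.^-distribˡ-+-* 2 a b)))

  1^n≡1 : ∀ n → 1# ^ n ≡ 1#
  1^n≡1 zero = refl
  1^n≡1 (suc n) = trans (*-identityˡ _) (1^n≡1 n)

  0^2^k≡0 : ∀ k → 0# ^ (2 ℕ.^ k) ≡ 0#
  0^2^k≡0 k with 2 ℕ.^ k | ℕP.m^n>0 2 k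
  ... | suc n | _ = zeroˡ _

  x⁻¹*x≡1 : ∀ {x} → x ≢ 0# → x ⁻¹ * x ≡ 1#
  x⁻¹*x≡1 {x} x≢0 = trans (*-comm _ _) (inverseʳ x x≢0)

  *-cancelˡ : ∀ {x y z} → x ≢ 0# → x * y ≡ x * z → y ≡ z
  *-cancelˡ {x} {y} {z} x≢0 eq = begin
    y                  ≡⟨ sym (*-identityˡ y) ⟩
    1# * y             ≡⟨ cong (_* y) (sym (x⁻¹*x≡1 x≢0)) ⟩
    (x ⁻¹ * x) * y     ≡⟨ *-assoc _ _ _ ⟩
    x ⁻¹ * (x * y)     ≡⟨ cong (x ⁻¹ *_) eq ⟩
    x ⁻¹ * (x * z)     ≡⟨ sym (*-assoc _ _ _) ⟩
    (x ⁻¹ * x) * z     ≡⟨ cong (_* z) (x⁻¹*x≡1 x≢0) ⟩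
    1# * z             ≡⟨ *-identityˡ z ⟩
    z                  ∎

  x⁻¹≢0 : ∀ {x} → x ≢ 0# → x ⁻¹ ≢ 0#
  x⁻¹≢0 {x} x≢0 x⁻¹≡0 = 0≢1 (trans (sym (zeroʳ x)) (trans (cong (x *_) (sym x⁻¹≡0)) (inverseʳ x x≢0)))

  x*y≡0⇒y≡0 : ∀ {x y} → x ≢ 0# → x * y ≡ 0# → y ≡ 0#
  x*y≡0⇒y≡0 {x} x≢0 eq = *-cancelˡ x≢0 (trans eq (sym (zeroʳ x)))

  x*y≢0 : ∀ {x y} → x ≢ 0# → y ≢ 0# → x * y ≢ 0#
  x*y≢0 x≢0 y≢0 = y≢0 ∘ x*y≡0⇒y≡0 x≢0

  x^n≢0 : ∀ {x} n → x ≢ 0# → x ^ n ≢ 0#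
  x^n≢0 zero x≢0 = 0≢1 ∘ sym
  x^n≢0 (suc n) x≢0 = x*y≢0 x≢0 (x^n≢0 n x≢0)

  x^n*x⁻¹^n≡1 : ∀ {x} → x ≢ 0# → ∀ n → x ^ n * x ⁻¹ ^ n ≡ 1#
  x^n*x⁻¹^n≡1 {x} x≢0 n = trans (sym (^-distribʳ-* x (x ⁻¹) n)) (trans (cong (_^ n) (inverseʳ x x≢0)) (1^n≡1 n))

  x⁻¹^[n+k]*x^n≡x⁻¹^k : ∀ {x} → x ≢ 0# → ∀ n k → x ⁻¹ ^ (n ℕ.+ k) * x ^ n ≡ x ⁻¹ ^ k
  x⁻¹^[n+k]*x^n≡x⁻¹^k {x} x≢0 n k = begin
    x ⁻¹ ^ (n ℕ.+ k) * x ^ n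
      ≡⟨ cong (_* x ^ n) (^-distribˡ-+-* (x ⁻¹) n k) ⟩
    x ⁻¹ ^ n * x ⁻¹ ^ k * x ^ n
      ≡⟨ solve 3 (λ a b c → a :* b :* c := b :* (c :* a)) refl (x ⁻¹ ^ n) (x ⁻¹ ^ k) (x ^ n) ⟩
    x ⁻¹ ^ k * (x ^ n * x ⁻¹ ^ n)
      ≡⟨ cong (x ⁻¹ ^ k *_) (x^n*x⁻¹^n≡1 x≢0 n) ⟩
    x ⁻¹ ^ k * 1#
      ≡⟨ *-identityʳ _ ⟩
    x ⁻¹ ^ k ∎

  _≟_ : DecidableEquality Carrier
  _≟_ = inj⇒≟ (↔⇒↣ card)

  *-commutativeMonoid : CommutativeMonoid 0ℓ 0ℓ
  *-commutativeMonoid = record { isCommutativeMonoid = *-isCommutativeMonoid }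

  open Algebra.Properties.CommutativeMonoid.Sum *-commutativeMonoid
    using () renaming (sum to ∏; sum-remove to ∏-remove; sum-permute to ∏-permute; sum-cong-≗ to ∏-cong)

  ∏-*ˡ : ∀ a {k} (g : Fin k → Carrier) → ∏ (λ j → a * g j) ≡ a ^ k * ∏ g
  ∏-*ˡ a {zero} g = sym (*-identityʳ _)
  ∏-*ˡ a {suc k} g = trans (cong ((a * g Fin.zero) *_) (∏-*ˡ a (g ∘ Fin.suc)))
    (solve 4 (λ a b c d → (a :* b) :* (c :* d) := (a :* c) :* (b :* d)) refl a (g Fin.zero) (a ^ k) (∏ (g ∘ Fin.suc)))

  ∏-≢0 : ∀ {k} (g : Fin k → Carrier) → (∀ j → g j ≢ 0#) → ∏ g ≢ 0#
  ∏-≢0 {zero} g _ = 0≢1 ∘ sym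
  ∏-≢0 {suc k} g g≢0 = x*y≢0 (g≢0 Fin.zero) (∏-≢0 (g ∘ Fin.suc) (g≢0 ∘ Fin.suc))

  -- Multiplication by a ≢ 0 permutes F, so the product of unzero (0 ↦ 1, y ↦ y)
  -- over F is both ∏ nonzero and a ^ n * ∏ nonzero.
  module _ {n : ℕ} (enum : Carrier ↔ Fin (suc n)) where
    private
      open Inverse enum using (to; from; strictlyInverseˡ; strictlyInverseʳ)

      nonzero : Fin n → Carrier
      nonzero j = from (punchIn (to 0#) j)

      nonzero≢0 : ∀ j → nonzero j ≢ 0#
      nonzero≢0 j eq = punchInᵢ≢i (to 0#) j (trans (sym (strictlyInverseˡ _)) (cong to eq))

      unzero : Carrier → Carrier
      unzero y with y ≟ 0#
      ... | yes _ = 1#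
      ... | no _ = y

      unzero-0 : unzero 0# ≡ 1#
      unzero-0 with 0# ≟ 0#
      ... | yes _ = refl
      ... | no 0≢0 = ⊥-elim (0≢0 refl)

      unzero-≢0 : ∀ {y} → y ≢ 0# → unzero y ≡ y
      unzero-≢0 {y} y≢0 with y ≟ 0#
      ... | yes y≡0 = ⊥-elim (y≢0 y≡0)
      ... | no _ = refl

      ∏-unzero : ∀ a → a ≢ 0# → ∏ (unzero ∘ (a *_) ∘ from) ≡ a ^ n * ∏ nonzero
      ∏-unzero a a≢0 = begin
        ∏ (unzero ∘ (a *_) ∘ from)
          ≡⟨ ∏-remove {i = to 0#} (unzero ∘ (a *_) ∘ from) ⟩
        unzero (a * from (to 0#)) * ∏ (λ j → unzero (a * nonzero j))
          ≡⟨ cong₂ _*_ (trans (cong (λ w → unzero (a * w)) (strictlyInverseʳ 0#)) (trans (cong unzero (zeroʳ a)) unzero-0))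
                       (∏-cong (λ j → unzero-≢0 (x*y≢0 a≢0 (nonzero≢0 j)))) ⟩
        1# * ∏ (λ j → a * nonzero j)
          ≡⟨ trans (*-identityˡ _) (∏-*ˡ a nonzero) ⟩
        a ^ n * ∏ nonzero ∎

      multiplyBy : ∀ a → a ≢ 0# → Permutation (suc n) (suc n)
      multiplyBy a a≢0 = permutation (λ i → to (a * from i)) (λ j → to (a ⁻¹ * from j)) cancel₁ cancel₂
        where
        cancel₁ : ∀ y → to (a * from (to (a ⁻¹ * from y))) ≡ y
        cancel₁ y = begin
          to (a * from (to (a ⁻¹ * from y))) ≡⟨ cong (λ w → to (a * w)) (strictlyInverseʳ _) ⟩
          to (a * (a ⁻¹ * from y))           ≡⟨ cong to (sym (*-assoc _ _ _)) ⟩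
          to ((a * a ⁻¹) * from y)           ≡⟨ cong (λ w → to (w * from y)) (inverseʳ a a≢0) ⟩
          to (1# * from y)                   ≡⟨ cong to (*-identityˡ _) ⟩
          to (from y)                        ≡⟨ strictlyInverseˡ y ⟩
          y                                  ∎
        cancel₂ : ∀ x → to (a ⁻¹ * from (to (a * from x))) ≡ x
        cancel₂ x = begin
          to (a ⁻¹ * from (to (a * from x))) ≡⟨ cong (λ w → to (a ⁻¹ * w)) (strictlyInverseʳ _) ⟩
          to (a ⁻¹ * (a * from x))           ≡⟨ cong to (sym (*-assoc _ _ _)) ⟩
          to ((a ⁻¹ * a) * from x)           ≡⟨ cong (λ w → to (w * from x)) (x⁻¹*x≡1 a≢0) ⟩
          to (1# * from x)                   ≡⟨ cong to (*-identityˡ _) ⟩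
          to (from x)                        ≡⟨ strictlyInverseˡ x ⟩
          x                                  ∎

    x^n≡1 : ∀ {a} → a ≢ 0# → a ^ n ≡ 1#
    x^n≡1 {a} a≢0 = sym (*-cancelˡ (∏-≢0 nonzero nonzero≢0) (begin
      ∏ nonzero * 1#
        ≡⟨ *-identityʳ _ ⟩
      ∏ nonzero
        ≡⟨ sym (trans (∏-unzero 1# (0≢1 ∘ sym)) (trans (cong (_* ∏ nonzero) (1^n≡1 n)) (*-identityˡ _))) ⟩
      ∏ (unzero ∘ (1# *_) ∘ from)
        ≡⟨ ∏-cong {suc n} (λ i → cong unzero (*-identityˡ (from i))) ⟩
      ∏ (unzero ∘ from)
        ≡⟨ ∏-permute (unzero ∘ from) (multiplyBy a a≢0) ⟩
      ∏ (λ i → unzero (from (to (a * from i))))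
        ≡⟨ ∏-cong {suc n} (λ i → cong unzero (strictlyInverseʳ (a * from i))) ⟩
      ∏ (unzero ∘ (a *_) ∘ from)
        ≡⟨ ∏-unzero a a≢0 ⟩
      a ^ n * ∏ nonzero
        ≡⟨ *-comm _ _ ⟩
      ∏ nonzero * a ^ n ∎))

  fermat : ∀ {n} → Carrier ↔ Fin n → ∀ x → x ^ n ≡ x
  fermat {zero} enum x = ⊥-elim (¬Fin0 (Inverse.to enum x))
  fermat {suc n} enum x with x ≟ 0#
  ... | yes refl = zeroˡ _
  ... | no x≢0 = trans (cong (x *_) (x^n≡1 enum x≢0)) (*-identityʳ x)

  ring : Ring 0ℓ 0ℓ
  ring = record { isRing = isRing }

  open Algebra.Properties.Ring ring using (-1*x≈-x; -‿involutive; +-inverseˡ-unique)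

  order : ℕ
  order = 2 ℕ.^ (3 ℕ.* suc m')

  x^order≡x : ∀ x → x ^ order ≡ x
  x^order≡x = fermat card

  -1≡1 : - 1# ≡ 1#
  -1≡1 = begin
    - 1#                ≡⟨ sym (x^order≡x (- 1#)) ⟩
    (- 1#) ^ (2 ℕ.* K)  ≡⟨ sym (^-*-assoc (- 1#) 2 K) ⟩
    ((- 1#) ^ 2) ^ K    ≡⟨ cong (_^ K) [-1]²≡1 ⟩
    1# ^ K              ≡⟨ 1^n≡1 K ⟩
    1#                  ∎
    where
    K : ℕ
    K = 2 ℕ.^ (3 ℕ.* suc m' ℕ.∸ 1)
    [-1]²≡1 : (- 1#) ^ 2 ≡ 1#
    [-1]²≡1 = trans (cong (- 1# *_) (*-identityʳ _)) (trans (-1*x≈-x (- 1#)) (-‿involutive 1#))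

  x+x≡0 : ∀ x → x + x ≡ 0#
  x+x≡0 x = begin
    x + x             ≡⟨ solve 1 (λ x → x :+ x := x :* (con 1 :+ con 1)) refl x ⟩
    x * (1# + 1#)     ≡⟨ cong (λ w → x * (w + 1#)) (sym -1≡1) ⟩
    x * (- 1# + 1#)   ≡⟨ cong (x *_) (-‿inverseˡ 1#) ⟩
    x * 0#            ≡⟨ zeroʳ x ⟩
    0#                ∎

  x+y≡0⇒x≡y : ∀ {x y} → x + y ≡ 0# → x ≡ y
  x+y≡0⇒x≡y {x} {y} eq = trans (+-inverseˡ-unique x y eq) (sym (+-inverseˡ-unique y y (x+x≡0 y)))

  x+y+y≡x : ∀ x y → x + y + y ≡ x
  x+y+y≡x x y = trans (+-assoc _ _ _) (trans (cong (x +_) (x+x≡0 y)) (+-identityʳ x))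

  x+y≡z⇒x≡y+z : ∀ {x y z} → x + y ≡ z → x ≡ y + z
  x+y≡z⇒x≡y+z {x} {y} eq = trans (sym (x+y+y≡x x y)) (trans (cong (_+ y) eq) (+-comm _ y))

  cancel-double : ∀ {a b} c → a ≡ b + (c + c) → a ≡ b
  cancel-double {b = b} c eq = trans eq (trans (cong (b +_) (x+x≡0 c)) (+-identityʳ b))

  [x+y]²≡x²+y² : ∀ x y → (x + y) ^ 2 ≡ x ^ 2 + y ^ 2
  [x+y]²≡x²+y² x y = cancel-double (x * y)
    (solve 2 (λ x y → (x :+ y) :^ 2 := x :^ 2 :+ y :^ 2 :+ (x :* y :+ x :* y)) refl x y)

  frobenius : ∀ k x y → (x + y) ^ (2 ℕ.^ k) ≡ x ^ (2 ℕ.^ k) + y ^ (2 ℕ.^ k)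
  frobenius zero x y = trans (^-identityʳ _) (sym (cong₂ _+_ (^-identityʳ x) (^-identityʳ y)))
  frobenius (suc k) x y = begin
    (x + y) ^ (2 ℕ.* 2 ℕ.^ k)                  ≡⟨ sym (^-*-assoc _ 2 (2 ℕ.^ k)) ⟩
    ((x + y) ^ 2) ^ (2 ℕ.^ k)                  ≡⟨ cong (_^ (2 ℕ.^ k)) ([x+y]²≡x²+y² x y) ⟩
    (x ^ 2 + y ^ 2) ^ (2 ℕ.^ k)                ≡⟨ frobenius k _ _ ⟩
    (x ^ 2) ^ (2 ℕ.^ k) + (y ^ 2) ^ (2 ℕ.^ k)  ≡⟨ cong₂ _+_ (^-*-assoc x 2 (2 ℕ.^ k)) (^-*-assoc y 2 (2 ℕ.^ k)) ⟩
    x ^ (2 ℕ.* 2 ℕ.^ k) + y ^ (2 ℕ.* 2 ℕ.^ k)  ∎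

  Σ<-cong : ∀ n {g h : ℕ → Carrier} → (∀ i → i ℕ.< n → g i ≡ h i) → Σ< n g ≡ Σ< n h
  Σ<-cong zero _ = refl
  Σ<-cong (suc n) g≡h = cong₂ _+_ (Σ<-cong n (λ i i<n → g≡h i (ℕP.m<n⇒m<1+n i<n))) (g≡h n ℕP.≤-refl)

  Σ<-distrib-+ : ∀ n g h → Σ< n (λ i → g i + h i) ≡ Σ< n g + Σ< n h
  Σ<-distrib-+ zero g h = sym (+-identityʳ 0#)
  Σ<-distrib-+ (suc n) g h = trans (cong (_+ (g n + h n)) (Σ<-distrib-+ n g h))
    (solve 4 (λ a b c d → a :+ b :+ (c :+ d) := a :+ c :+ (b :+ d)) refl (Σ< n g) (Σ< n h) (g n) (h n))

  Σ<-*ˡ : ∀ n c g → Σ< n (λ i → c * g i) ≡ c * Σ< n g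
  Σ<-*ˡ zero c g = sym (zeroʳ c)
  Σ<-*ˡ (suc n) c g = trans (cong (_+ c * g n) (Σ<-*ˡ n c g)) (sym (distribˡ _ _ _))

  Σ<-zero : ∀ n g → (∀ i → i ℕ.< n → g i ≡ 0#) → Σ< n g ≡ 0#
  Σ<-zero n g g≡0 = trans (Σ<-cong n g≡0) (zeros n)
    where
    zeros : ∀ n → Σ< n (λ _ → 0#) ≡ 0#
    zeros zero = refl
    zeros (suc n) = trans (+-identityʳ _) (zeros n)

  Σ<-single : ∀ n g j → j ℕ.< n → (∀ i → i ℕ.< n → i ≢ j → g i ≡ 0#) → Σ< n g ≡ g j
  Σ<-single (suc n) g j j<1+n others with j ℕ.≟ n
  ... | yes refl = trans (cong (_+ g j) (Σ<-zero n g (λ i i<n → others i (ℕP.m<n⇒m<1+n i<n) (ℕP.<⇒≢ i<n))))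
                         (+-identityˡ _)
  ... | no j≢n = trans (cong₂ _+_ (Σ<-single n g j (ℕP.≤∧≢⇒< (ℕP.≤-pred j<1+n) j≢n)
                                             (λ i i<n → others i (ℕP.m<n⇒m<1+n i<n)))
                                  (others n ℕP.≤-refl (j≢n ∘ sym)))
                       (+-identityʳ _)

  Σ<-telescope : ∀ n (h : ℕ → Carrier) → Σ< n (λ i → h (suc i) + h i) ≡ h n + h 0
  Σ<-telescope zero h = sym (x+x≡0 (h 0))
  Σ<-telescope (suc n) h = begin
    Σ< n (λ i → h (suc i) + h i) + (h (suc n) + h n)
      ≡⟨ cong (_+ (h (suc n) + h n)) (Σ<-telescope n h) ⟩
    h n + h 0 + (h (suc n) + h n)
      ≡⟨ cancel-double (h n) (solve 3 (λ a b c → a :+ b :+ (c :+ a) := c :+ b :+ (a :+ a)) refl (h n) (h 0) (h (suc n))) ⟩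
    h (suc n) + h 0 ∎

-- Polynomials as coefficient lists, constant term first.
module Polynomials {m' : ℕ} (F : GF-q³ (suc m')) (l : ℕ) (δ : GF-q³.Carrier F) where
  open GF-q³ F
  open Setup F l δ using (_^_; Σ<)
  open Field F l δ
  open IsCommutativeRing isCommutativeRing hiding (refl; sym; trans)
  open import Algebra.Solver.Ring.NaturalCoefficients.Default commutativeSemiring
  open ≡-Reasoning

  Poly : Set
  Poly = List Carrier

  eval : Poly → Carrier → Carrier
  eval [] x = 0#
  eval (c ∷ p) x = c + x * eval p x

  -- synthetic division by x + a, i.e. by x - a
  quotient : Carrier → Poly → Poly
  quotient a [] = []
  quotient a (c ∷ []) = []
  quotient a (c ∷ c′ ∷ p) = eval (c′ ∷ p) a ∷ quotient a (c′ ∷ p)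

  length-quotient : ∀ a p → length (quotient a p) ≡ ℕ.pred (length p)
  length-quotient a [] = refl
  length-quotient a (c ∷ []) = refl
  length-quotient a (c ∷ c′ ∷ p) = cong suc (length-quotient a (c′ ∷ p))

  eval-quotient : ∀ a p x → eval p x ≡ (x + a) * eval (quotient a p) x + eval p a
  eval-quotient a [] x = sym (trans (+-identityʳ _) (zeroʳ _))
  eval-quotient a (c ∷ []) x =
    solve 3 (λ a c x → c :+ x :* con 0 := (x :+ a) :* con 0 :+ (c :+ a :* con 0)) refl a c x
  eval-quotient a (c ∷ c′ ∷ p) x = begin
    c + x * r x
      ≡⟨ cong (λ w → c + x * w) (eval-quotient a (c′ ∷ p) x) ⟩
    c + x * ((x + a) * s + r a)
      ≡⟨ sym (cancel-double (a * r a) (solve 5 (λ c x a s ra →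
           (x :+ a) :* (ra :+ x :* s) :+ (c :+ a :* ra)
           := c :+ x :* ((x :+ a) :* s :+ ra) :+ (a :* ra :+ a :* ra))
           refl c x a s (r a))) ⟩
    (x + a) * (r a + x * s) + (c + a * r a) ∎
    where
    r : Carrier → Carrier
    r = eval (c′ ∷ p)
    s : Carrier
    s = eval (quotient a (c′ ∷ p)) x

  zero-quotient⇒zero : ∀ a p → eval p a ≡ 0# → All (_≡ 0#) (quotient a p) → All (_≡ 0#) p
  zero-quotient⇒zero a [] _ _ = []
  zero-quotient⇒zero a (c ∷ []) pa≡0 _ = trans (sym (trans (cong (c +_) (zeroʳ a)) (+-identityʳ c))) pa≡0 ∷ []
  zero-quotient⇒zero a (c ∷ c′ ∷ p) pa≡0 (ra≡0 ∷ q≡0) = c≡0 ∷ zero-quotient⇒zero a (c′ ∷ p) ra≡0 q≡0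
    where
    c≡0 : c ≡ 0#
    c≡0 = begin
      c                       ≡⟨ solve 2 (λ c a → c := c :+ a :* con 0) refl c a ⟩
      c + a * 0#              ≡⟨ cong (λ w → c + a * w) (sym ra≡0) ⟩
      c + a * eval (c′ ∷ p) a ≡⟨ pa≡0 ⟩
      0#                      ∎

  roots-of-quotient : ∀ a p bs → All (a ≢_) bs → eval p a ≡ 0# →
                      All (λ b → eval p b ≡ 0#) bs → All (λ b → eval (quotient a p) b ≡ 0#) bs
  roots-of-quotient a p [] [] _ [] = []
  roots-of-quotient a p (b ∷ bs) (a≢b ∷ a≢bs) pa≡0 (pb≡0 ∷ pbs≡0) =
    x*y≡0⇒y≡0 (a≢b ∘ sym ∘ x+y≡0⇒x≡y) (begin
      (b + a) * eval (quotient a p) b       ≡⟨ sym (+-identityʳ _) ⟩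
      (b + a) * eval (quotient a p) b + 0#  ≡⟨ cong ((b + a) * eval (quotient a p) b +_) (sym pa≡0) ⟩
      (b + a) * eval (quotient a p) b + eval p a ≡⟨ sym (eval-quotient a p b) ⟩
      eval p b                              ≡⟨ pb≡0 ⟩
      0#                                    ∎)
    ∷ roots-of-quotient a p bs a≢bs pa≡0 pbs≡0

  root-bound : ∀ (as : List Carrier) → AllPairs _≢_ as → ∀ p → length p ℕ.≤ length as →
               All (λ a → eval p a ≡ 0#) as → All (_≡ 0#) p
  root-bound [] _ [] _ _ = []
  root-bound (a ∷ as) (a≢as ∷ distinct) p len (pa≡0 ∷ pas≡0) =
    zero-quotient⇒zero a p pa≡0
      (root-bound as distinct (quotient a p)
        (subst (ℕ._≤ length as) (sym (length-quotient a p)) (ℕP.pred-mono-≤ len))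
        (roots-of-quotient a p as a≢as pa≡0 pas≡0))

  vanishing⇒zero : ∀ p → length p ℕ.≤ order → (∀ x → eval p x ≡ 0#) → All (_≡ 0#) p
  vanishing⇒zero p len p≡0 =
    root-bound elements (tabulate⁺ (λ eq → trans (sym (strictlyInverseˡ _)) (trans (cong to eq) (strictlyInverseˡ _))))
      p (subst (length p ℕ.≤_) (sym (length-tabulate from)) len) (All.tabulate λ {x} _ → p≡0 x)
    where
    open Inverse card using (to; from; strictlyInverseˡ)
    elements : List Carrier
    elements = List.tabulate from

  monomial : ℕ → Poly
  monomial zero = 1# ∷ []
  monomial (suc k) = 0# ∷ monomial k

  infixl 6 _⊕_
  _⊕_ : Poly → Poly → Poly
  [] ⊕ q = q
  (a ∷ p) ⊕ [] = a ∷ p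
  (a ∷ p) ⊕ (b ∷ q) = (a + b) ∷ (p ⊕ q)

  scale : Carrier → Poly → Poly
  scale c = List.map (c *_)

  Σ-poly : ℕ → (ℕ → Poly) → Poly
  Σ-poly zero P = []
  Σ-poly (suc n) P = Σ-poly n P ⊕ P n

  coef : Poly → ℕ → Carrier
  coef [] k = 0#
  coef (c ∷ p) zero = c
  coef (c ∷ p) (suc k) = coef p k

  eval-monomial : ∀ k x → eval (monomial k) x ≡ x ^ k
  eval-monomial zero x = trans (cong (1# +_) (zeroʳ x)) (+-identityʳ 1#)
  eval-monomial (suc k) x = trans (+-identityˡ _) (cong (x *_) (eval-monomial k x))

  eval-⊕ : ∀ p q x → eval (p ⊕ q) x ≡ eval p x + eval q x
  eval-⊕ [] q x = sym (+-identityˡ _)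
  eval-⊕ (a ∷ p) [] x = sym (+-identityʳ _)
  eval-⊕ (a ∷ p) (b ∷ q) x = trans (cong (λ w → a + b + x * w) (eval-⊕ p q x))
    (solve 5 (λ a b x p q → a :+ b :+ x :* (p :+ q) := a :+ x :* p :+ (b :+ x :* q)) refl a b x (eval p x) (eval q x))

  eval-scale : ∀ c p x → eval (scale c p) x ≡ c * eval p x
  eval-scale c [] x = sym (zeroʳ c)
  eval-scale c (a ∷ p) x = trans (cong (λ w → c * a + x * w) (eval-scale c p x))
    (solve 4 (λ c a x p → c :* a :+ x :* (c :* p) := c :* (a :+ x :* p)) refl c a x (eval p x))

  eval-Σ-poly : ∀ n P x → eval (Σ-poly n P) x ≡ Σ< n (λ i → eval (P i) x)
  eval-Σ-poly zero P x = refl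
  eval-Σ-poly (suc n) P x = trans (eval-⊕ (Σ-poly n P) (P n) x) (cong (_+ eval (P n) x) (eval-Σ-poly n P x))

  coef-⊕ : ∀ p q k → coef (p ⊕ q) k ≡ coef p k + coef q k
  coef-⊕ [] q k = sym (+-identityˡ _)
  coef-⊕ (a ∷ p) [] zero = sym (+-identityʳ _)
  coef-⊕ (a ∷ p) [] (suc k) = sym (+-identityʳ _)
  coef-⊕ (a ∷ p) (b ∷ q) zero = refl
  coef-⊕ (a ∷ p) (b ∷ q) (suc k) = coef-⊕ p q k

  coef-scale : ∀ c p k → coef (scale c p) k ≡ c * coef p k
  coef-scale c [] k = sym (zeroʳ c)
  coef-scale c (a ∷ p) zero = refl
  coef-scale c (a ∷ p) (suc k) = coef-scale c p k

  coef-Σ-poly : ∀ n P k → coef (Σ-poly n P) k ≡ Σ< n (λ i → coef (P i) k)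
  coef-Σ-poly zero P k = refl
  coef-Σ-poly (suc n) P k = trans (coef-⊕ (Σ-poly n P) (P n) k) (cong (_+ coef (P n) k) (coef-Σ-poly n P k))

  coef-monomial-≡ : ∀ k → coef (monomial k) k ≡ 1#
  coef-monomial-≡ zero = refl
  coef-monomial-≡ (suc k) = coef-monomial-≡ k

  coef-monomial-≢ : ∀ {j k} → j ≢ k → coef (monomial j) k ≡ 0#
  coef-monomial-≢ {zero} {zero} 0≢0 = ⊥-elim (0≢0 refl)
  coef-monomial-≢ {zero} {suc k} _ = refl
  coef-monomial-≢ {suc j} {zero} _ = refl
  coef-monomial-≢ {suc j} {suc k} j≢k = coef-monomial-≢ (j≢k ∘ cong suc)

  coef-zero : ∀ p k → All (_≡ 0#) p → coef p k ≡ 0#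
  coef-zero [] k _ = refl
  coef-zero (c ∷ p) zero (c≡0 ∷ _) = c≡0
  coef-zero (c ∷ p) (suc k) (_ ∷ p≡0) = coef-zero p k p≡0

  length-monomial : ∀ k → length (monomial k) ≡ suc k
  length-monomial zero = refl
  length-monomial (suc k) = cong suc (length-monomial k)

  length-⊕ : ∀ {n} p q → length p ℕ.≤ n → length q ℕ.≤ n → length (p ⊕ q) ℕ.≤ n
  length-⊕ [] q _ q≤n = q≤n
  length-⊕ (a ∷ p) [] p≤n _ = p≤n
  length-⊕ (a ∷ p) (b ∷ q) (ℕ.s≤s p≤n) (ℕ.s≤s q≤n) = ℕ.s≤s (length-⊕ p q p≤n q≤n)

  length-scale : ∀ c p → length (scale c p) ≡ length p
  length-scale c = length-map (c *_)

  length-Σ-poly : ∀ {k} n P → (∀ i → i ℕ.< n → length (P i) ℕ.≤ k) → length (Σ-poly n P) ℕ.≤ k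
  length-Σ-poly zero P _ = ℕ.z≤n
  length-Σ-poly (suc n) P P≤k =
    length-⊕ (Σ-poly n P) (P n) (length-Σ-poly n P (λ i i<n → P≤k i (ℕP.m<n⇒m<1+n i<n))) (P≤k n ℕP.≤-refl)

module Subfield {m' : ℕ} (F : GF-q³ (suc m')) (l : ℕ) (δ : GF-q³.Carrier F) where
  open GF-q³ F
  open Setup F l δ using (_^_; q; Tr; InFq; root2^l)
  open Field F l δ
  open IsCommutativeRing isCommutativeRing hiding (refl; sym; trans)
  open import Algebra.Solver.Ring.NaturalCoefficients.Default commutativeSemiring
  open ≡-Reasoning

  m : ℕ
  m = suc m'

  q*q≡2^[m+m] : q ℕ.* q ≡ 2 ℕ.^ (m ℕ.+ m)
  q*q≡2^[m+m] = sym (ℕP.^-distribˡ-+-* 2 m m)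

  x^[q*q*q]≡x : ∀ x → x ^ (q ℕ.* q ℕ.* q) ≡ x
  x^[q*q*q]≡x x = trans (cong (x ^_) q*q*q≡order) (x^order≡x x)
    where
    q*q*q≡order : q ℕ.* q ℕ.* q ≡ order
    q*q*q≡order = begin
      q ℕ.* q ℕ.* q
        ≡⟨ cong (ℕ._* q) q*q≡2^[m+m] ⟩
      2 ℕ.^ (m ℕ.+ m) ℕ.* q
        ≡⟨ sym (ℕP.^-distribˡ-+-* 2 (m ℕ.+ m) m) ⟩
      2 ℕ.^ (m ℕ.+ m ℕ.+ m)
        ≡⟨ cong (2 ℕ.^_) (trans (ℕP.+-assoc m m m) (cong (λ w → m ℕ.+ (m ℕ.+ w)) (sym (ℕP.+-identityʳ m)))) ⟩
      order ∎

  ^q-distrib-+ : ∀ x y → (x + y) ^ q ≡ x ^ q + y ^ q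
  ^q-distrib-+ = frobenius m

  ^[q*q]-distrib-+ : ∀ x y → (x + y) ^ (q ℕ.* q) ≡ x ^ (q ℕ.* q) + y ^ (q ℕ.* q)
  ^[q*q]-distrib-+ x y = begin
    (x + y) ^ (q ℕ.* q)          ≡⟨ sym (^-*-assoc (x + y) q q) ⟩
    ((x + y) ^ q) ^ q            ≡⟨ cong (_^ q) (^q-distrib-+ x y) ⟩
    (x ^ q + y ^ q) ^ q          ≡⟨ ^q-distrib-+ _ _ ⟩
    (x ^ q) ^ q + (y ^ q) ^ q    ≡⟨ cong₂ _+_ (^-*-assoc x q q) (^-*-assoc y q q) ⟩
    x ^ (q ℕ.* q) + y ^ (q ℕ.* q) ∎

  InFq-0 : InFq 0#
  InFq-0 = 0^2^k≡0 m

  InFq-^ : ∀ {x} n → InFq x → InFq (x ^ n)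
  InFq-^ {x} n x∈ = trans (^-^-comm x n q) (cong (_^ n) x∈)

  InFq⇒x^[q*q]≡x : ∀ {x} → InFq x → x ^ (q ℕ.* q) ≡ x
  InFq⇒x^[q*q]≡x {x} x∈ = trans (sym (^-*-assoc x q q)) (trans (cong (_^ q) x∈) x∈)

  InFq⇒x^2^[k*m]≡x : ∀ {x} → InFq x → ∀ k → x ^ (2 ℕ.^ (k ℕ.* m)) ≡ x
  InFq⇒x^2^[k*m]≡x x∈ zero = ^-identityʳ _
  InFq⇒x^2^[k*m]≡x {x} x∈ (suc k) = begin
    x ^ (2 ℕ.^ (m ℕ.+ k ℕ.* m))        ≡⟨ cong (x ^_) (ℕP.^-distribˡ-+-* 2 m (k ℕ.* m)) ⟩
    x ^ (q ℕ.* 2 ℕ.^ (k ℕ.* m))        ≡⟨ sym (^-*-assoc x q _) ⟩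
    (x ^ q) ^ (2 ℕ.^ (k ℕ.* m))        ≡⟨ cong (_^ (2 ℕ.^ (k ℕ.* m))) x∈ ⟩
    x ^ (2 ℕ.^ (k ℕ.* m))              ≡⟨ InFq⇒x^2^[k*m]≡x x∈ k ⟩
    x                                  ∎

  Tr-InFq : ∀ x → InFq (Tr x)
  Tr-InFq x = begin
    (x + x ^ q + x ^ (q ℕ.* q)) ^ q
      ≡⟨ trans (^q-distrib-+ _ _) (cong (_+ (x ^ (q ℕ.* q)) ^ q) (^q-distrib-+ _ _)) ⟩
    x ^ q + (x ^ q) ^ q + (x ^ (q ℕ.* q)) ^ q
      ≡⟨ cong₂ (λ u v → x ^ q + u + v) (^-*-assoc x q q)
           (trans (^-*-assoc x (q ℕ.* q) q) (x^[q*q*q]≡x x)) ⟩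
    x ^ q + x ^ (q ℕ.* q) + x
      ≡⟨ solve 3 (λ a b c → a :+ b :+ c := c :+ a :+ b) refl (x ^ q) (x ^ (q ℕ.* q)) x ⟩
    x + x ^ q + x ^ (q ℕ.* q) ∎

  Tr-InFq-id : ∀ {x} → InFq x → Tr x ≡ x
  Tr-InFq-id {x} x∈ = trans (cong₂ (λ u v → x + u + v) x∈ (InFq⇒x^[q*q]≡x x∈)) (x+y+y≡x x x)

  Tr-+ : ∀ x y → Tr (x + y) ≡ Tr x + Tr y
  Tr-+ x y = begin
    x + y + (x + y) ^ q + (x + y) ^ (q ℕ.* q)
      ≡⟨ cong₂ (λ u v → x + y + u + v) (^q-distrib-+ x y) (^[q*q]-distrib-+ x y) ⟩
    x + y + (x ^ q + y ^ q) + (x ^ (q ℕ.* q) + y ^ (q ℕ.* q))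
      ≡⟨ solve 6 (λ a b c d e f → a :+ b :+ (c :+ d) :+ (e :+ f) := a :+ c :+ e :+ (b :+ d :+ f))
           refl x y (x ^ q) (y ^ q) (x ^ (q ℕ.* q)) (y ^ (q ℕ.* q)) ⟩
    Tr x + Tr y ∎

  Tr-^2^ : ∀ x k → Tr (x ^ (2 ℕ.^ k)) ≡ Tr x ^ (2 ℕ.^ k)
  Tr-^2^ x k = begin
    x ^ K + (x ^ K) ^ q + (x ^ K) ^ (q ℕ.* q)
      ≡⟨ cong₂ (λ u v → x ^ K + u + v) (^-^-comm x K q) (^-^-comm x K (q ℕ.* q)) ⟩
    x ^ K + (x ^ q) ^ K + (x ^ (q ℕ.* q)) ^ K
      ≡⟨ sym (trans (frobenius k _ _) (cong (_+ (x ^ (q ℕ.* q)) ^ K) (frobenius k _ _))) ⟩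
    Tr x ^ K ∎
    where
    K : ℕ
    K = 2 ℕ.^ k

  Tr^2^ : ∀ x r → Tr x ^ (2 ℕ.^ r) ≡ x ^ (2 ℕ.^ r) + x ^ (2 ℕ.^ (m ℕ.+ r)) + x ^ (2 ℕ.^ (m ℕ.+ m ℕ.+ r))
  Tr^2^ x r = begin
    (x + x ^ q + x ^ (q ℕ.* q)) ^ (2 ℕ.^ r)
      ≡⟨ trans (frobenius r _ _) (cong (_+ (x ^ (q ℕ.* q)) ^ (2 ℕ.^ r)) (frobenius r _ _)) ⟩
    x ^ (2 ℕ.^ r) + (x ^ q) ^ (2 ℕ.^ r) + (x ^ (q ℕ.* q)) ^ (2 ℕ.^ r)
      ≡⟨ cong₂ (λ u v → x ^ (2 ℕ.^ r) + u + v) (^-^-2^ x m r)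
           (trans (cong (λ w → (x ^ w) ^ (2 ℕ.^ r)) q*q≡2^[m+m]) (^-^-2^ x (m ℕ.+ m) r)) ⟩
    x ^ (2 ℕ.^ r) + x ^ (2 ℕ.^ (m ℕ.+ r)) + x ^ (2 ℕ.^ (m ℕ.+ m ℕ.+ r)) ∎

  root2^l-inverse : ∀ x → (x ^ (2 ℕ.^ l)) ^ root2^l ≡ x
  root2^l-inverse x = begin
    (x ^ (2 ℕ.^ l)) ^ (2 ℕ.^ (3 ℕ.* m ℕ.* l ℕ.∸ l))
      ≡⟨ ^-^-2^ x l _ ⟩
    x ^ (2 ℕ.^ (l ℕ.+ (3 ℕ.* m ℕ.* l ℕ.∸ l)))
      ≡⟨ cong (λ w → x ^ (2 ℕ.^ w)) (trans (ℕP.m+[n∸m]≡n (ℕP.m≤n*m l (3 ℕ.* m))) (ℕP.*-comm (3 ℕ.* m) l)) ⟩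
    x ^ (2 ℕ.^ (l ℕ.* (3 ℕ.* m)))
      ≡⟨ iterate l ⟩
    x ∎
    where
    iterate : ∀ k → x ^ (2 ℕ.^ (k ℕ.* (3 ℕ.* m))) ≡ x
    iterate zero = ^-identityʳ x
    iterate (suc k) = begin
      x ^ (2 ℕ.^ (3 ℕ.* m ℕ.+ k ℕ.* (3 ℕ.* m)))  ≡⟨ sym (^-^-2^ x (3 ℕ.* m) (k ℕ.* (3 ℕ.* m))) ⟩
      (x ^ order) ^ (2 ℕ.^ (k ℕ.* (3 ℕ.* m)))    ≡⟨ cong (_^ (2 ℕ.^ (k ℕ.* (3 ℕ.* m)))) (x^order≡x x) ⟩
      x ^ (2 ℕ.^ (k ℕ.* (3 ℕ.* m)))              ≡⟨ iterate k ⟩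
      x                                          ∎

  root2^l-distrib-+ : ∀ x y → (x + y) ^ root2^l ≡ x ^ root2^l + y ^ root2^l
  root2^l-distrib-+ = frobenius (3 ℕ.* m ℕ.* l ℕ.∸ l)

-- Over F_q, the maps u ↦ u ^ 2 ^ e with distinct e < m are linearly independent:
-- substituting u = Tr y turns a vanishing combination into a polynomial in y of
-- degree < q^3 vanishing on F_{q^3}, and 2 ^ e is one of its exponents.
module Linearised {m' : ℕ} (F : GF-q³ (suc m')) (l : ℕ) (δ : GF-q³.Carrier F) where
  open GF-q³ F
  open Setup F l δ using (_^_; Σ<; Tr; InFq)
  open Field F l δ
  open Polynomials F l δ
  open Subfield F l δ
  open IsCommutativeRing isCommutativeRing hiding (refl; sym; trans)
  open ≡-Reasoning

  monomial-2^ : ℕ → Poly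
  monomial-2^ k = monomial (2 ℕ.^ k)

  eval-monomial-2^ : ∀ k y → eval (monomial-2^ k) y ≡ y ^ (2 ℕ.^ k)
  eval-monomial-2^ k = eval-monomial (2 ℕ.^ k)

  coef-monomial-2^-≢ : ∀ {j k} → j ≢ k → coef (monomial-2^ j) (2 ℕ.^ k) ≡ 0#
  coef-monomial-2^-≢ j≢k = coef-monomial-≢ (j≢k ∘ 2^-injective)

  length-monomial-2^ : ∀ {k} → k ℕ.< 3 ℕ.* m → length (monomial-2^ k) ℕ.≤ order
  length-monomial-2^ {k} k<3m = subst (ℕ._≤ order) (sym (length-monomial (2 ℕ.^ k)))
    (ℕP.<-≤-trans (ℕP.m<m+n (2 ℕ.^ k) (ℕP.m^n>0 2 k))
      (ℕP.≤-trans (ℕP.+-monoʳ-≤ (2 ℕ.^ k) (ℕP.m≤m+n _ 0)) (ℕP.^-monoʳ-≤ 2 k<3m)))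

  trace-poly : ℕ → Poly
  trace-poly r = monomial-2^ r ⊕ monomial-2^ (m ℕ.+ r) ⊕ monomial-2^ (m ℕ.+ m ℕ.+ r)

  eval-trace-poly : ∀ r y → eval (trace-poly r) y ≡ Tr y ^ (2 ℕ.^ r)
  eval-trace-poly r y = begin
    eval (p₀ ⊕ p₁ ⊕ p₂) y
      ≡⟨ trans (eval-⊕ (p₀ ⊕ p₁) p₂ y) (cong (_+ eval p₂ y) (eval-⊕ p₀ p₁ y)) ⟩
    eval p₀ y + eval p₁ y + eval p₂ y
      ≡⟨ cong₂ _+_ (cong₂ _+_ (eval-monomial-2^ r y) (eval-monomial-2^ (m ℕ.+ r) y)) (eval-monomial-2^ (m ℕ.+ m ℕ.+ r) y) ⟩
    y ^ (2 ℕ.^ r) + y ^ (2 ℕ.^ (m ℕ.+ r)) + y ^ (2 ℕ.^ (m ℕ.+ m ℕ.+ r))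
      ≡⟨ sym (Tr^2^ y r) ⟩
    Tr y ^ (2 ℕ.^ r) ∎
    where
    p₀ p₁ p₂ : Poly
    p₀ = monomial-2^ r
    p₁ = monomial-2^ (m ℕ.+ r)
    p₂ = monomial-2^ (m ℕ.+ m ℕ.+ r)

  coef-trace-poly : ∀ r k → coef (trace-poly r) k
                    ≡ coef (monomial-2^ r) k + coef (monomial-2^ (m ℕ.+ r)) k + coef (monomial-2^ (m ℕ.+ m ℕ.+ r)) k
  coef-trace-poly r k = trans (coef-⊕ (p₀ ⊕ p₁) p₂ k) (cong (_+ coef p₂ k) (coef-⊕ p₀ p₁ k))
    where
    p₀ p₁ p₂ : Poly
    p₀ = monomial-2^ r
    p₁ = monomial-2^ (m ℕ.+ r)
    p₂ = monomial-2^ (m ℕ.+ m ℕ.+ r)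

  coef-trace-poly-≡ : ∀ r → coef (trace-poly r) (2 ℕ.^ r) ≡ 1#
  coef-trace-poly-≡ r = begin
    coef (trace-poly r) (2 ℕ.^ r)
      ≡⟨ coef-trace-poly r (2 ℕ.^ r) ⟩
    _ + _ + _
      ≡⟨ cong₂ _+_ (cong₂ _+_ (coef-monomial-≡ (2 ℕ.^ r)) (coef-monomial-2^-≢ (1+k+r≢r m')))
           (coef-monomial-2^-≢ (1+k+r≢r (m' ℕ.+ m))) ⟩
    1# + 0# + 0#
      ≡⟨ x+y+y≡x 1# 0# ⟩
    1# ∎
    where
    1+k+r≢r : ∀ k → suc k ℕ.+ r ≢ r
    1+k+r≢r k eq = ℕP.m+1+n≢m r (trans (ℕP.+-comm r (suc k)) eq)

  coef-trace-poly-≢ : ∀ {r s} → s ℕ.< m → r ≢ s → coef (trace-poly r) (2 ℕ.^ s) ≡ 0#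
  coef-trace-poly-≢ {r} {s} s<m r≢s = begin
    coef (trace-poly r) (2 ℕ.^ s)
      ≡⟨ coef-trace-poly r (2 ℕ.^ s) ⟩
    _ + _ + _
      ≡⟨ cong₂ _+_ (cong₂ _+_ (coef-monomial-2^-≢ r≢s) (coef-monomial-2^-≢ (≥m⇒≢s (ℕP.m≤m+n m r))))
           (coef-monomial-2^-≢ (≥m⇒≢s (ℕP.≤-trans (ℕP.m≤m+n m m) (ℕP.m≤m+n (m ℕ.+ m) r)))) ⟩
    0# + 0# + 0#
      ≡⟨ x+y+y≡x 0# 0# ⟩
    0# ∎
    where
    ≥m⇒≢s : ∀ {k} → m ℕ.≤ k → k ≢ s
    ≥m⇒≢s m≤k refl = ℕP.<⇒≱ s<m m≤k

  length-trace-poly : ∀ r → r ℕ.< m → length (trace-poly r) ℕ.≤ order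
  length-trace-poly r r<m =
    length-⊕ (monomial-2^ r ⊕ monomial-2^ (m ℕ.+ r)) (monomial-2^ (m ℕ.+ m ℕ.+ r))
      (length-⊕ (monomial-2^ r) (monomial-2^ (m ℕ.+ r))
        (length-monomial-2^ (ℕP.≤-<-trans (ℕP.m≤n+m r (m ℕ.+ m)) 2m+r<3m))
        (length-monomial-2^ (ℕP.≤-<-trans (ℕP.+-monoˡ-≤ r (ℕP.m≤m+n m m)) 2m+r<3m)))
      (length-monomial-2^ 2m+r<3m)
    where
    2m+r<3m : m ℕ.+ m ℕ.+ r ℕ.< 3 ℕ.* m
    2m+r<3m = subst (m ℕ.+ m ℕ.+ r ℕ.<_) (trans (ℕP.+-assoc m m m) (cong (λ w → m ℕ.+ (m ℕ.+ w)) (sym (ℕP.+-identityʳ m))))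
                (ℕP.+-monoʳ-< (m ℕ.+ m) r<m)

  linearised-coefficients-vanish :
    ∀ n (c : ℕ → Carrier) (e : ℕ → ℕ) → (∀ i → i ℕ.< n → e i ℕ.< m) →
    (∀ {i j} → i ℕ.< n → j ℕ.< n → e i ≡ e j → i ≡ j) →
    (∀ u → InFq u → Σ< n (λ i → c i * u ^ (2 ℕ.^ e i)) ≡ 0#) →
    ∀ j → j ℕ.< n → c j ≡ 0#
  linearised-coefficients-vanish n c e e<m e-injective vanishes j j<n = begin
    c j
      ≡⟨ sym (trans (cong (c j *_) (coef-trace-poly-≡ (e j))) (*-identityʳ (c j))) ⟩
    c j * coef (trace-poly (e j)) (2 ℕ.^ e j)
      ≡⟨ sym (Σ<-single n _ j j<n others) ⟩
    Σ< n (λ i → c i * coef (trace-poly (e i)) (2 ℕ.^ e j))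
      ≡⟨ Σ<-cong n (λ i _ → sym (coef-scale (c i) (trace-poly (e i)) (2 ℕ.^ e j))) ⟩
    Σ< n (λ i → coef (scale (c i) (trace-poly (e i))) (2 ℕ.^ e j))
      ≡⟨ sym (coef-Σ-poly n (λ i → scale (c i) (trace-poly (e i))) (2 ℕ.^ e j)) ⟩
    coef P (2 ℕ.^ e j)
      ≡⟨ coef-zero P _ (vanishing⇒zero P length-P eval-P) ⟩
    0# ∎
    where
    P : Poly
    P = Σ-poly n (λ i → scale (c i) (trace-poly (e i)))
    others : ∀ i → i ℕ.< n → i ≢ j → c i * coef (trace-poly (e i)) (2 ℕ.^ e j) ≡ 0#
    others i i<n i≢j = trans (cong (c i *_) (coef-trace-poly-≢ (e<m j j<n) (i≢j ∘ e-injective i<n j<n))) (zeroʳ (c i))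
    length-P : length P ℕ.≤ order
    length-P = length-Σ-poly n _ λ i i<n →
      subst (ℕ._≤ order) (sym (length-scale (c i) (trace-poly (e i)))) (length-trace-poly (e i) (e<m i i<n))
    eval-P : ∀ y → eval P y ≡ 0#
    eval-P y = begin
      eval P y
        ≡⟨ eval-Σ-poly n _ y ⟩
      Σ< n (λ i → eval (scale (c i) (trace-poly (e i))) y)
        ≡⟨ Σ<-cong n (λ i _ → trans (eval-scale (c i) (trace-poly (e i)) y) (cong (c i *_) (eval-trace-poly (e i) y))) ⟩
      Σ< n (λ i → c i * Tr y ^ (2 ℕ.^ e i))
        ≡⟨ vanishes (Tr y) (Tr-InFq y) ⟩
      0# ∎

-- With T = Tr x ∈ F_q, the conjugates of (T + δ) ^ e are P (T + δ), P (T + δ₁), P (T + δ₂)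
-- for P = (T + δ) (T + δ₁) (T + δ₂), which makes Tr (f x) + D a quartic in T.
module Reduction {m' : ℕ} (F : GF-q³ (suc m')) (l : ℕ) (δ : GF-q³.Carrier F) where
  open GF-q³ F
  open Setup F l δ
  open Field F l δ
  open Subfield F l δ
  open IsCommutativeRing isCommutativeRing hiding (refl; sym; trans)
  open import Algebra.Solver.Ring.NaturalCoefficients.Default commutativeSemiring
  open ≡-Reasoning

  Λ : Carrier → Carrier
  Λ T = T ^ 4 + B * T ^ 2 + A * T

  δ₁ δ₂ : Carrier
  δ₁ = δ ^ q
  δ₂ = δ ^ (q ℕ.* q)

  δ₁^q≡δ₂ : δ₁ ^ q ≡ δ₂
  δ₁^q≡δ₂ = ^-*-assoc δ q q

  δ₂^q≡δ : δ₂ ^ q ≡ δ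
  δ₂^q≡δ = trans (^-*-assoc δ (q ℕ.* q) q) (x^[q*q*q]≡x δ)

  Tr≡conjugates : ∀ x → Tr x ≡ x + x ^ q + (x ^ q) ^ q
  Tr≡conjugates x = cong (λ v → x + x ^ q + v) (sym (^-*-assoc x q q))

  ^q-^2 : ∀ x → (x ^ 2) ^ q ≡ (x ^ q) ^ 2
  ^q-^2 x = ^-^-comm x 2 q

  B≡ : B ≡ δ ^ 2 + δ * δ₁ + (δ₁ ^ 2 + δ₁ * δ₂) + (δ₂ ^ 2 + δ₂ * δ)
  B≡ = begin
    Tr (δ ^ 2 + δ * δ₁)
      ≡⟨ Tr≡conjugates _ ⟩
    δ ^ 2 + δ * δ₁ + (δ ^ 2 + δ * δ₁) ^ q + ((δ ^ 2 + δ * δ₁) ^ q) ^ q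
      ≡⟨ cong₂ (λ u v → δ ^ 2 + δ * δ₁ + u + v) (conj δ δ₁ δ₂ refl δ₁^q≡δ₂)
           (trans (cong (_^ q) (conj δ δ₁ δ₂ refl δ₁^q≡δ₂)) (conj δ₁ δ₂ δ δ₁^q≡δ₂ δ₂^q≡δ)) ⟩
    δ ^ 2 + δ * δ₁ + (δ₁ ^ 2 + δ₁ * δ₂) + (δ₂ ^ 2 + δ₂ * δ) ∎
    where
    conj : ∀ x y z → x ^ q ≡ y → y ^ q ≡ z → (x ^ 2 + x * y) ^ q ≡ y ^ 2 + y * z
    conj x y z x^q≡y y^q≡z = begin
      (x ^ 2 + x * y) ^ q        ≡⟨ trans (^q-distrib-+ _ _) (cong₂ _+_ (^q-^2 x) (^-distribʳ-* x y q)) ⟩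
      (x ^ q) ^ 2 + x ^ q * y ^ q ≡⟨ cong₂ (λ u v → u ^ 2 + u * v) x^q≡y y^q≡z ⟩
      y ^ 2 + y * z              ∎

  A≡ : A ≡ δ ^ 2 * δ₁ + δ ^ 2 * δ₂ + (δ₁ ^ 2 * δ₂ + δ₁ ^ 2 * δ) + (δ₂ ^ 2 * δ + δ₂ ^ 2 * δ₁)
  A≡ = begin
    Tr (δ ^ (2 ℕ.+ q) + δ ^ (2 ℕ.+ q ℕ.* q))
      ≡⟨ cong Tr (cong₂ _+_ (^-distribˡ-+-* δ 2 q) (^-distribˡ-+-* δ 2 (q ℕ.* q))) ⟩
    Tr (δ ^ 2 * δ₁ + δ ^ 2 * δ₂)
      ≡⟨ Tr≡conjugates _ ⟩
    δ ^ 2 * δ₁ + δ ^ 2 * δ₂ + (δ ^ 2 * δ₁ + δ ^ 2 * δ₂) ^ q + ((δ ^ 2 * δ₁ + δ ^ 2 * δ₂) ^ q) ^ q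
      ≡⟨ cong₂ (λ u v → δ ^ 2 * δ₁ + δ ^ 2 * δ₂ + u + v) (conj δ δ₁ δ₂ δ refl δ₁^q≡δ₂ δ₂^q≡δ)
           (trans (cong (_^ q) (conj δ δ₁ δ₂ δ refl δ₁^q≡δ₂ δ₂^q≡δ)) (conj δ₁ δ₂ δ δ₁ δ₁^q≡δ₂ δ₂^q≡δ refl)) ⟩
    δ ^ 2 * δ₁ + δ ^ 2 * δ₂ + (δ₁ ^ 2 * δ₂ + δ₁ ^ 2 * δ) + (δ₂ ^ 2 * δ + δ₂ ^ 2 * δ₁) ∎
    where
    conj : ∀ x y z w → x ^ q ≡ y → y ^ q ≡ z → z ^ q ≡ w → (x ^ 2 * y + x ^ 2 * z) ^ q ≡ y ^ 2 * z + y ^ 2 * w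
    conj x y z w x^q≡y y^q≡z z^q≡w = begin
      (x ^ 2 * y + x ^ 2 * z) ^ q
        ≡⟨ trans (^q-distrib-+ _ _) (cong₂ _+_ (^-distribʳ-* _ y q) (^-distribʳ-* _ z q)) ⟩
      (x ^ 2) ^ q * y ^ q + (x ^ 2) ^ q * z ^ q
        ≡⟨ cong (λ u → u * y ^ q + u * z ^ q) (trans (^q-^2 x) (cong (_^ 2) x^q≡y)) ⟩
      y ^ 2 * y ^ q + y ^ 2 * z ^ q
        ≡⟨ cong₂ (λ u v → y ^ 2 * u + y ^ 2 * v) y^q≡z z^q≡w ⟩
      y ^ 2 * z + y ^ 2 * w ∎

  D≡ : D ≡ δ₂ * δ₁ * δ * (δ + δ₁ + δ₂)
  D≡ = cong (_* Tr δ) (trans (^-distribˡ-+-* δ (q ℕ.* q ℕ.+ q) 1)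
                             (cong₂ _*_ (^-distribˡ-+-* δ (q ℕ.* q) q) (^-identityʳ δ)))

  [T+x]^q : ∀ {T} → InFq T → ∀ x → (T + x) ^ q ≡ T + x ^ q
  [T+x]^q {T} T∈ x = trans (^q-distrib-+ T x) (cong (_+ x ^ q) T∈)

  [T+x]^e : ∀ {T x y z} → InFq T → x ^ q ≡ y → y ^ q ≡ z → (T + x) ^ e ≡ (T + z) * (T + y) * (T + x) ^ 2
  [T+x]^e {T} {x} {y} {z} T∈ x^q≡y y^q≡z = begin
    (T + x) ^ (q ℕ.* q ℕ.+ q ℕ.+ 2)                  ≡⟨ ^-distribˡ-+-* (T + x) (q ℕ.* q ℕ.+ q) 2 ⟩
    (T + x) ^ (q ℕ.* q ℕ.+ q) * (T + x) ^ 2          ≡⟨ cong (_* (T + x) ^ 2) (^-distribˡ-+-* (T + x) (q ℕ.* q) q) ⟩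
    (T + x) ^ (q ℕ.* q) * (T + x) ^ q * (T + x) ^ 2  ≡⟨ cong₂ (λ u v → u * v * (T + x) ^ 2) [T+x]^[q*q] [T+x]^q≡T+y ⟩
    (T + z) * (T + y) * (T + x) ^ 2                  ∎
    where
    [T+x]^q≡T+y : (T + x) ^ q ≡ T + y
    [T+x]^q≡T+y = trans ([T+x]^q T∈ x) (cong (T +_) x^q≡y)
    [T+x]^[q*q] : (T + x) ^ (q ℕ.* q) ≡ T + z
    [T+x]^[q*q] = trans (sym (^-*-assoc (T + x) q q))
                    (trans (cong (_^ q) [T+x]^q≡T+y) (trans ([T+x]^q T∈ y) (cong (T +_) y^q≡z)))

  [[T+x]^e]^q : ∀ {T} → InFq T → ∀ x → ((T + x) ^ e) ^ q ≡ (T + x ^ q) ^ e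
  [[T+x]^e]^q {T} T∈ x = trans (^-^-comm (T + x) e q) (cong (_^ e) ([T+x]^q T∈ x))

  conjugate-sum-identity : ∀ T a b c →
    (T + c) * (T + b) * (T + a) ^ 2 + (T + a) * (T + c) * (T + b) ^ 2 + (T + b) * (T + a) * (T + c) ^ 2
      + c * b * a * (a + b + c)
    ≡ T ^ 4 + (a ^ 2 + a * b + (b ^ 2 + b * c) + (c ^ 2 + c * a)) * T ^ 2
        + (a ^ 2 * b + a ^ 2 * c + (b ^ 2 * c + b ^ 2 * a) + (c ^ 2 * a + c ^ 2 * b)) * T
  conjugate-sum-identity T a b c = cancel-double
    ((a + b + c) * T ^ 3 + (a * b + b * c + c * a) * T ^ 2 + (a * b * c + a * b * c) * T
      + a * b * c * (a + b + c) + (T + a) * (T + b) * (T + c) * T)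
    (solve 4 (λ T a b c →
      (T :+ c) :* (T :+ b) :* (T :+ a) :^ 2 :+ (T :+ a) :* (T :+ c) :* (T :+ b) :^ 2
        :+ (T :+ b) :* (T :+ a) :* (T :+ c) :^ 2 :+ c :* b :* a :* (a :+ b :+ c)
      := T :^ 4 :+ (a :^ 2 :+ a :* b :+ (b :^ 2 :+ b :* c) :+ (c :^ 2 :+ c :* a)) :* T :^ 2
           :+ (a :^ 2 :* b :+ a :^ 2 :* c :+ (b :^ 2 :* c :+ b :^ 2 :* a) :+ (c :^ 2 :* a :+ c :^ 2 :* b)) :* T
         :+ (E T a b c :+ E T a b c)) refl T a b c)
    where
    E : ∀ {n} → Polynomial n → Polynomial n → Polynomial n → Polynomial n → Polynomial n
    E T a b c = (a :+ b :+ c) :* T :^ 3 :+ (a :* b :+ b :* c :+ c :* a) :* T :^ 2 :+ (a :* b :* c :+ a :* b :* c) :* T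
                  :+ a :* b :* c :* (a :+ b :+ c) :+ (T :+ a) :* (T :+ b) :* (T :+ c) :* T

  Tr[f]≡Tr[[Tr+δ]^e] : ∀ x → Tr (f x) ≡ Tr ((Tr x + δ) ^ e)
  Tr[f]≡Tr[[Tr+δ]^e] x = begin
    Tr (G + T′ + x ^ (2 ℕ.^ l))
      ≡⟨ trans (Tr-+ _ _) (cong (_+ Tr (x ^ (2 ℕ.^ l))) (Tr-+ G T′)) ⟩
    Tr G + Tr T′ + Tr (x ^ (2 ℕ.^ l))
      ≡⟨ cong₂ (λ u v → Tr G + u + v) (Tr-InFq-id (InFq-^ (2 ℕ.^ l) (Tr-InFq x))) (Tr-^2^ x l) ⟩
    Tr G + T′ + T′
      ≡⟨ x+y+y≡x (Tr G) T′ ⟩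
    Tr G ∎
    where
    G T′ : Carrier
    G = (Tr x + δ) ^ e
    T′ = Tr x ^ (2 ℕ.^ l)

  Tr[[T+δ]^e] : ∀ {T} → InFq T → Tr ((T + δ) ^ e)
                ≡ (T + δ₂) * (T + δ₁) * (T + δ) ^ 2 + (T + δ) * (T + δ₂) * (T + δ₁) ^ 2 + (T + δ₁) * (T + δ) * (T + δ₂) ^ 2
  Tr[[T+δ]^e] {T} T∈ = begin
    Tr G
      ≡⟨ Tr≡conjugates G ⟩
    G + G ^ q + (G ^ q) ^ q
      ≡⟨ cong₂ (λ u v → G + u + v) ([[T+x]^e]^q T∈ δ)
           (trans (cong (_^ q) ([[T+x]^e]^q T∈ δ)) (trans ([[T+x]^e]^q T∈ δ₁) (cong (λ w → (T + w) ^ e) δ₁^q≡δ₂))) ⟩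
    G + (T + δ₁) ^ e + (T + δ₂) ^ e
      ≡⟨ cong₂ _+_ (cong₂ _+_ ([T+x]^e T∈ refl δ₁^q≡δ₂) ([T+x]^e T∈ δ₁^q≡δ₂ δ₂^q≡δ)) ([T+x]^e T∈ δ₂^q≡δ refl) ⟩
    (T + δ₂) * (T + δ₁) * (T + δ) ^ 2 + (T + δ) * (T + δ₂) * (T + δ₁) ^ 2 + (T + δ₁) * (T + δ) * (T + δ₂) ^ 2 ∎
    where
    G : Carrier
    G = (T + δ) ^ e

  Tr[f]+D≡Λ[Tr] : ∀ x → Tr (f x) + D ≡ Λ (Tr x)
  Tr[f]+D≡Λ[Tr] x = begin
    Tr (f x) + D
      ≡⟨ cong₂ _+_ (trans (Tr[f]≡Tr[[Tr+δ]^e] x) (Tr[[T+δ]^e] (Tr-InFq x))) D≡ ⟩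
    (T + δ₂) * (T + δ₁) * (T + δ) ^ 2 + (T + δ) * (T + δ₂) * (T + δ₁) ^ 2 + (T + δ₁) * (T + δ) * (T + δ₂) ^ 2
      + δ₂ * δ₁ * δ * (δ + δ₁ + δ₂)
      ≡⟨ conjugate-sum-identity T δ δ₁ δ₂ ⟩
    T ^ 4 + (δ ^ 2 + δ * δ₁ + (δ₁ ^ 2 + δ₁ * δ₂) + (δ₂ ^ 2 + δ₂ * δ)) * T ^ 2
      + (δ ^ 2 * δ₁ + δ ^ 2 * δ₂ + (δ₁ ^ 2 * δ₂ + δ₁ ^ 2 * δ) + (δ₂ ^ 2 * δ + δ₂ ^ 2 * δ₁)) * T
      ≡⟨ sym (cong₂ (λ u v → T ^ 4 + u * T ^ 2 + v * T) B≡ A≡) ⟩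
    Λ T ∎
    where
    T : Carrier
    T = Tr x

module Inversion {m' : ℕ} (F : GF-q³ (suc m')) (l : ℕ) (δ : GF-q³.Carrier F) where
  open GF-q³ F
  open Setup F l δ
  open Field F l δ
  open Subfield F l δ
  open Reduction F l δ
  open IsCommutativeRing isCommutativeRing hiding (refl; sym; trans)
  open import Algebra.Solver.Ring.NaturalCoefficients.Default commutativeSemiring
  open ≡-Reasoning

  InFq-A : InFq A
  InFq-A = Tr-InFq _

  InFq-B : InFq B
  InFq-B = Tr-InFq _

  -- D = Tr (f 0), because Tr (f 0) + D = Λ (Tr 0) = 0.
  InFq-D : InFq D
  InFq-D = subst InFq (x+y≡0⇒x≡y (trans (Tr[f]+D≡Λ[Tr] 0#) Λ[Tr0]≡0)) (Tr-InFq (f 0#))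
    where
    Λ[Tr0]≡0 : Λ (Tr 0#) ≡ 0#
    Λ[Tr0]≡0 = begin
      Λ (0# + 0# ^ q + 0# ^ (q ℕ.* q))
        ≡⟨ cong (λ w → Λ (0# + 0# ^ q + w)) (InFq⇒x^[q*q]≡x InFq-0) ⟩
      Λ (0# + 0# ^ q + 0#)
        ≡⟨ cong (λ w → Λ (0# + w + 0#)) InFq-0 ⟩
      Λ (0# + 0# + 0#)
        ≡⟨ solve 2 (λ A B → (con 0 :+ con 0 :+ con 0) :^ 4 :+ B :* (con 0 :+ con 0 :+ con 0) :^ 2
             :+ A :* (con 0 :+ con 0 :+ con 0) := con 0) refl A B ⟩
      0# ∎

  Λ-surjective : Surjective _≡_ _≡_ f → ∀ u → InFq u → ∃ λ T → InFq T × Λ T ≡ u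
  Λ-surjective surjective u u∈ = Tr x , Tr-InFq x , (begin
      Λ (Tr x)        ≡⟨ sym (Tr[f]+D≡Λ[Tr] x) ⟩
      Tr (f x) + D    ≡⟨ cong (λ w → Tr w + D) (proj₂ (surjective (u + D)) refl) ⟩
      Tr (u + D) + D  ≡⟨ cong (_+ D) (trans (Tr-+ u D) (cong₂ _+_ (Tr-InFq-id u∈) (Tr-InFq-id InFq-D))) ⟩
      u + D + D       ≡⟨ x+y+y≡x u D ⟩
      u               ∎)
    where
    x : Carrier
    x = proj₁ (surjective (u + D))

  inverse-candidate : (Carrier → Carrier) → Carrier → Carrier
  inverse-candidate R y = ((δ + R (Tr y + D)) ^ e) ^ root2^l + y ^ root2^l + R (Tr y + D)

  inverse-candidate-∘-f : ∀ R → (∀ T → InFq T → R (Λ T) ≡ T) → ∀ x → inverse-candidate R (f x) ≡ x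
  inverse-candidate-∘-f R R∘Λ≡id x = begin
    ((δ + R (Tr (f x) + D)) ^ e) ^ r + f x ^ r + R (Tr (f x) + D)
      ≡⟨ cong (λ w → ((δ + R w) ^ e) ^ r + f x ^ r + R w) (Tr[f]+D≡Λ[Tr] x) ⟩
    ((δ + R (Λ T)) ^ e) ^ r + f x ^ r + R (Λ T)
      ≡⟨ cong (λ w → ((δ + w) ^ e) ^ r + f x ^ r + w) (R∘Λ≡id T (Tr-InFq x)) ⟩
    ((δ + T) ^ e) ^ r + f x ^ r + T
      ≡⟨ cong₂ (λ u v → (u ^ e) ^ r + v + T) (+-comm δ T) f[x]^r≡ ⟩
    X + (X + T + x) + T
      ≡⟨ cancel-double X (cancel-double T (solve 3 (λ X T x →
           X :+ (X :+ T :+ x) :+ T := x :+ (X :+ X) :+ (T :+ T)) refl X T x)) ⟩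
    x ∎
    where
    r : ℕ
    r = root2^l
    T : Carrier
    T = Tr x
    X : Carrier
    X = ((T + δ) ^ e) ^ r
    f[x]^r≡ : f x ^ r ≡ X + T + x
    f[x]^r≡ = trans (root2^l-distrib-+ _ _)
                (cong₂ _+_ (trans (root2^l-distrib-+ _ _) (cong (X +_) (root2^l-inverse T))) (root2^l-inverse x))

  left-inverse⇒IsCompInverse : Bijective _≡_ _≡_ f → ∀ g → (∀ x → g (f x) ≡ x) → IsCompInverse g
  left-inverse⇒IsCompInverse (_ , surjective) g g∘f≡id = f∘g≡id , g∘f≡id
    where
    f∘g≡id : ∀ y → f (g y) ≡ y
    f∘g≡id y = begin
      f (g y)          ≡⟨ cong (f ∘ g) (sym fx≡y) ⟩
      f (g (f x))      ≡⟨ cong f (g∘f≡id x) ⟩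
      f x              ≡⟨ fx≡y ⟩
      y                ∎
      where
      x : Carrier
      x = proj₁ (surjective y)
      fx≡y : f x ≡ y
      fx≡y = proj₂ (surjective y) refl

module Case₁ {m' : ℕ} (F : GF-q³ (suc m')) (l : ℕ) (δ : GF-q³.Carrier F) where
  open GF-q³ F
  open Setup F l δ
  open Field F l δ
  open Subfield F l δ
  open Reduction F l δ
  open Inversion F l δ
  open IsCommutativeRing isCommutativeRing hiding (refl; sym; trans)
  open import Algebra.Solver.Ring.NaturalCoefficients.Default commutativeSemiring
  open ≡-Reasoning

  Λ-retraction : A ≡ 0# → B ≡ 0# → ∀ T → InFq T → Λ T ^ qOver4 ≡ T
  Λ-retraction A≡0 B≡0 T T∈ = begin
    (T ^ 4 + B * T ^ 2 + A * T) ^ qOver4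
      ≡⟨ cong₂ (λ b a → (T ^ 4 + b * T ^ 2 + a * T) ^ qOver4) B≡0 A≡0 ⟩
    (T ^ 4 + 0# * T ^ 2 + 0# * T) ^ qOver4
      ≡⟨ cong (_^ qOver4) (solve 1 (λ T → T :^ 4 :+ con 0 :* T :^ 2 :+ con 0 :* T := T :^ 4) refl T) ⟩
    (T ^ (2 ℕ.^ 2)) ^ (2 ℕ.^ (4 ℕ.* m ℕ.∸ 2))
      ≡⟨ ^-^-2^ T 2 (4 ℕ.* m ℕ.∸ 2) ⟩
    T ^ (2 ℕ.^ (2 ℕ.+ (4 ℕ.* m ℕ.∸ 2)))
      ≡⟨ cong (λ w → T ^ (2 ℕ.^ w)) (ℕP.m+[n∸m]≡n (ℕP.≤-trans (ℕ.s≤s (ℕ.s≤s ℕ.z≤n)) (ℕP.m≤m*n 4 m))) ⟩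
    T ^ (2 ℕ.^ (4 ℕ.* m))
      ≡⟨ InFq⇒x^2^[k*m]≡x T∈ 4 ⟩
    T ∎

  finv₁≡inverse-candidate : ∀ y → finv₁ y ≡ inverse-candidate (_^ qOver4) y
  finv₁≡inverse-candidate y = trans (cong (λ w → y ^ root2^l + (w ^ e) ^ root2^l + u ^ qOver4) (+-comm _ δ))
    (solve 3 (λ a b c → a :+ b :+ c := b :+ a :+ c) refl (y ^ root2^l) (((δ + u ^ qOver4) ^ e) ^ root2^l) (u ^ qOver4))
    where
    u : Carrier
    u = Tr y + D

  case₁ : Bijective _≡_ _≡_ f → A ≡ 0# → B ≡ 0# → IsCompInverse finv₁
  case₁ bijective A≡0 B≡0 = left-inverse⇒IsCompInverse bijective finv₁ λ x →
    trans (finv₁≡inverse-candidate (f x)) (inverse-candidate-∘-f (_^ qOver4) (Λ-retraction A≡0 B≡0) x)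

module Case₂ {m' : ℕ} (F : GF-q³ (suc m')) (l : ℕ) (δ : GF-q³.Carrier F) where
  open GF-q³ F
  open Setup F l δ
  open Field F l δ
  open Subfield F l δ
  open Reduction F l δ
  open Inversion F l δ
  open Linearised F l δ
  open IsCommutativeRing isCommutativeRing hiding (refl; sym; trans)
  open import Algebra.Solver.Ring.NaturalCoefficients.Default commutativeSemiring
  open ≡-Reasoning

  -- For m = 2k + 1, (a ^ geom₄ (k + 1)) ^ 3 = a ^ (4 ^ (k + 1) - 1) = a ^ (2q - 1) = a.
  odd⇒IsCubeInFq : ∀ k → m ≡ suc (2 ℕ.* k) → ∀ {a} → InFq a → a ≢ 0# → IsCubeInFq a
  odd⇒IsCubeInFq k m≡2k+1 {a} a∈ a≢0 = y , InFq-^ g a∈ , *-cancelˡ a≢0 a*y³≡a*a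
    where
    g : ℕ
    g = geom₄ (suc k)
    y : Carrier
    y = a ^ g
    a*y³≡a*a : a * (y * y * y) ≡ a * a
    a*y³≡a*a = begin
      a * (y * y * y)
        ≡⟨ cong (a *_) (trans (solve 1 (λ y → y :* y :* y := y :^ 3) refl y) (^-*-assoc a g 3)) ⟩
      a ^ suc (g ℕ.* 3)
        ≡⟨ cong (a ^_) (sym (4^n≡1+geom₄*3 (suc k))) ⟩
      a ^ (4 ℕ.^ suc k)
        ≡⟨ cong (a ^_) (trans (4^n≡2^[2*n] (suc k)) (cong (2 ℕ.^_) (trans (ℕP.*-suc 2 k) (cong suc (sym m≡2k+1))))) ⟩
      a ^ (2 ℕ.* q)
        ≡⟨ sym (^-*-assoc a 2 q) ⟩
      (a ^ 2) ^ q
        ≡⟨ trans (^-^-comm a 2 q) (cong (_^ 2) a∈) ⟩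
      a * (a * 1#)
        ≡⟨ cong (a *_) (*-identityʳ a) ⟩
      a * a ∎

  module Even (k : ℕ) (m≡2k : m ≡ 2 ℕ.* k) (A≢0 : A ≢ 0#) (B≡0 : B ≡ 0#) where
    d≡2 : d ≡ 2
    d≡2 = trans (cong (λ w → gcd w 2) m≡2k) (gcd[2*k,2]≡2 k)

    [2^m∸1]/[2^d∸1]≡geom₄ : ∀ {d′} → d′ ≡ 2 → .{{_ : NonZero (2 ℕ.^ d′ ℕ.∸ 1)}} →
                            (2 ℕ.^ m ℕ.∸ 1) ℕ./ (2 ℕ.^ d′ ℕ.∸ 1) ≡ geom₄ k
    [2^m∸1]/[2^d∸1]≡geom₄ refl = trans (cong (λ w → (w ℕ.∸ 1) ℕ./ 3) (trans (cong (2 ℕ.^_) m≡2k) (sym (4^n≡2^[2*n] k))))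
                                       ([4^n∸1]/3≡geom₄ k)

    m/d≡k : ∀ {d′} → d′ ≡ 2 → .{{_ : NonZero d′}} → m ℕ./ d′ ≡ k
    m/d≡k refl = trans (cong (ℕ._/ 2) (trans m≡2k (ℕP.*-comm 2 k))) (m*n/n≡m k 2)

    Nrm≡ : Nrm ≡ A ^ geom₄ k
    Nrm≡ = cong (A ^_) ([2^m∸1]/[2^d∸1]≡geom₄ d≡2 {{2^d-1-nonZero}})

    Nrm*A⁻¹^geom₄≡1 : Nrm * A ⁻¹ ^ geom₄ k ≡ 1#
    Nrm*A⁻¹^geom₄≡1 = trans (cong (_* A ⁻¹ ^ geom₄ k) Nrm≡) (x^n*x⁻¹^n≡1 A≢0 (geom₄ k))

    L′ : Carrier → Carrier
    L′ u = Σ< k (λ i → A ⁻¹ ^ geom₄ (suc i) * u ^ (4 ℕ.^ i))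

    -- L x = R₂ (Tr x + D), so finv₂ = inverse-candidate R₂
    R₂ : Carrier → Carrier
    R₂ u = (Nrm * ((1# + Nrm) ⁻¹)) * Σ< (m ℕ./ d) (λ i → (A ⁻¹) ^ ((4 ℕ.^ (suc i) ℕ.∸ 1) ℕ./ 3) * u ^ (4 ℕ.^ i))

    R₂≡ : ∀ u → R₂ u ≡ (Nrm * ((1# + Nrm) ⁻¹)) * L′ u
    R₂≡ u = cong ((Nrm * ((1# + Nrm) ⁻¹)) *_)
      (trans (cong (λ n → Σ< n (λ i → (A ⁻¹) ^ ((4 ℕ.^ (suc i) ℕ.∸ 1) ℕ./ 3) * u ^ (4 ℕ.^ i))) (m/d≡k d≡2))
             (Σ<-cong k (λ i _ → cong (λ w → A ⁻¹ ^ w * u ^ (4 ℕ.^ i)) ([4^n∸1]/3≡geom₄ (suc i)))))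

    L′∘Λ : ∀ T → InFq T → L′ (Λ T) ≡ A ⁻¹ ^ geom₄ k * T + T
    L′∘Λ T T∈ = begin
      L′ (Λ T)
        ≡⟨ Σ<-cong k (λ i _ → term i) ⟩
      Σ< k (λ i → c (suc i) + c i)
        ≡⟨ Σ<-telescope k c ⟩
      c k + c 0
        ≡⟨ cong₂ _+_ (cong (A ⁻¹ ^ geom₄ k *_) T^4^k≡T) (trans (*-identityˡ _) (^-identityʳ T)) ⟩
      A ⁻¹ ^ geom₄ k * T + T ∎
      where
      c : ℕ → Carrier
      c i = A ⁻¹ ^ geom₄ i * T ^ (4 ℕ.^ i)
      T^4^k≡T : T ^ (4 ℕ.^ k) ≡ T
      T^4^k≡T = trans (cong (T ^_) (trans (4^n≡2^[2*n] k) (cong (2 ℕ.^_) (sym m≡2k)))) T∈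
      frobenius₄ : ∀ i x y → (x + y) ^ (4 ℕ.^ i) ≡ x ^ (4 ℕ.^ i) + y ^ (4 ℕ.^ i)
      frobenius₄ i x y = begin
        (x + y) ^ (4 ℕ.^ i)
          ≡⟨ cong ((x + y) ^_) (4^n≡2^[2*n] i) ⟩
        (x + y) ^ (2 ℕ.^ (2 ℕ.* i))
          ≡⟨ frobenius (2 ℕ.* i) x y ⟩
        x ^ (2 ℕ.^ (2 ℕ.* i)) + y ^ (2 ℕ.^ (2 ℕ.* i))
          ≡⟨ sym (cong₂ (λ u v → x ^ u + y ^ v) (4^n≡2^[2*n] i) (4^n≡2^[2*n] i)) ⟩
        x ^ (4 ℕ.^ i) + y ^ (4 ℕ.^ i) ∎
      term : ∀ i → A ⁻¹ ^ geom₄ (suc i) * Λ T ^ (4 ℕ.^ i) ≡ c (suc i) + c i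
      term i = begin
        a * Λ T ^ (4 ℕ.^ i)
          ≡⟨ cong (λ b → a * (T ^ 4 + b * T ^ 2 + A * T) ^ (4 ℕ.^ i)) B≡0 ⟩
        a * (T ^ 4 + 0# * T ^ 2 + A * T) ^ (4 ℕ.^ i)
          ≡⟨ cong (λ w → a * w ^ (4 ℕ.^ i)) (solve 2 (λ T A → T :^ 4 :+ con 0 :* T :^ 2 :+ A :* T := T :^ 4 :+ A :* T) refl T A) ⟩
        a * (T ^ 4 + A * T) ^ (4 ℕ.^ i)
          ≡⟨ cong (a *_) (trans (frobenius₄ i _ _) (cong₂ _+_ (^-*-assoc T 4 (4 ℕ.^ i)) (^-distribʳ-* A T (4 ℕ.^ i)))) ⟩
        a * (T ^ (4 ℕ.^ suc i) + A ^ (4 ℕ.^ i) * T ^ (4 ℕ.^ i))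
          ≡⟨ solve 4 (λ a t′ x t → a :* (t′ :+ x :* t) := a :* t′ :+ (a :* x) :* t)
                   refl a (T ^ (4 ℕ.^ suc i)) (A ^ (4 ℕ.^ i)) (T ^ (4 ℕ.^ i)) ⟩
        c (suc i) + (a * A ^ (4 ℕ.^ i)) * T ^ (4 ℕ.^ i)
          ≡⟨ cong (λ w → c (suc i) + w * T ^ (4 ℕ.^ i)) (x⁻¹^[n+k]*x^n≡x⁻¹^k A≢0 (4 ℕ.^ i) (geom₄ i)) ⟩
        c (suc i) + c i ∎
        where
        a : Carrier
        a = A ⁻¹ ^ geom₄ (suc i)

    1+Nrm≢0 : Surjective _≡_ _≡_ f → 1# + Nrm ≢ 0#
    1+Nrm≢0 surjective 1+Nrm≡0 = x⁻¹≢0 A≢0 (trans (sym (*-identityʳ (A ⁻¹)))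
      (linearised-coefficients-vanish k (λ i → A ⁻¹ ^ geom₄ (suc i)) (2 ℕ.*_) 2i<m 2i-injective L′-vanishes 0 0<k))
      where
      0<k : 0 ℕ.< k
      0<k = positive k m≡2k
        where
        positive : ∀ k → m ≡ 2 ℕ.* k → 0 ℕ.< k
        positive (suc _) _ = ℕ.s≤s ℕ.z≤n
      2i<m : ∀ i → i ℕ.< k → 2 ℕ.* i ℕ.< m
      2i<m i i<k = subst (2 ℕ.* i ℕ.<_) (sym m≡2k) (ℕP.*-monoʳ-< 2 i<k)
      2i-injective : ∀ {i j} → i ℕ.< k → j ℕ.< k → 2 ℕ.* i ≡ 2 ℕ.* j → i ≡ j
      2i-injective _ _ = ℕP.*-cancelˡ-≡ _ _ 2
      A⁻¹^geom₄≡1 : A ⁻¹ ^ geom₄ k ≡ 1#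
      A⁻¹^geom₄≡1 = trans (sym (*-identityˡ _))
                      (trans (cong (_* A ⁻¹ ^ geom₄ k) (x+y≡0⇒x≡y 1+Nrm≡0)) Nrm*A⁻¹^geom₄≡1)
      L′-vanishes : ∀ u → InFq u → Σ< k (λ i → A ⁻¹ ^ geom₄ (suc i) * u ^ (2 ℕ.^ (2 ℕ.* i))) ≡ 0#
      L′-vanishes u u∈ = begin
        Σ< k (λ i → A ⁻¹ ^ geom₄ (suc i) * u ^ (2 ℕ.^ (2 ℕ.* i)))
          ≡⟨ Σ<-cong k (λ i _ → cong (λ w → A ⁻¹ ^ geom₄ (suc i) * u ^ w) (sym (4^n≡2^[2*n] i))) ⟩
        L′ u
          ≡⟨ cong L′ (sym ΛT≡u) ⟩
        L′ (Λ T)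
          ≡⟨ L′∘Λ T T∈ ⟩
        A ⁻¹ ^ geom₄ k * T + T
          ≡⟨ cong (λ w → w * T + T) A⁻¹^geom₄≡1 ⟩
        1# * T + T
          ≡⟨ trans (cong (_+ T) (*-identityˡ T)) (x+x≡0 T) ⟩
        0# ∎
        where
        T : Carrier
        T = proj₁ (Λ-surjective surjective u u∈)
        T∈ : InFq T
        T∈ = proj₁ (proj₂ (Λ-surjective surjective u u∈))
        ΛT≡u : Λ T ≡ u
        ΛT≡u = proj₂ (proj₂ (Λ-surjective surjective u u∈))

    R₂-retraction : Surjective _≡_ _≡_ f → ∀ T → InFq T → R₂ (Λ T) ≡ T
    R₂-retraction surjective T T∈ = begin
      R₂ (Λ T)
        ≡⟨ R₂≡ (Λ T) ⟩
      (Nrm * I) * L′ (Λ T)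
        ≡⟨ cong ((Nrm * I) *_) (L′∘Λ T T∈) ⟩
      (Nrm * I) * (A ⁻¹ ^ geom₄ k * T + T)
        ≡⟨ solve 4 (λ n i a t → (n :* i) :* (a :* t :+ t) := i :* ((n :* a) :* t :+ n :* t)) refl Nrm I (A ⁻¹ ^ geom₄ k) T ⟩
      I * ((Nrm * A ⁻¹ ^ geom₄ k) * T + Nrm * T)
        ≡⟨ cong (λ w → I * (w * T + Nrm * T)) Nrm*A⁻¹^geom₄≡1 ⟩
      I * (1# * T + Nrm * T)
        ≡⟨ solve 3 (λ i t n → i :* (con 1 :* t :+ n :* t) := (i :* (con 1 :+ n)) :* t) refl I T Nrm ⟩
      (I * (1# + Nrm)) * T
        ≡⟨ cong (_* T) (x⁻¹*x≡1 (1+Nrm≢0 surjective)) ⟩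
      1# * T
        ≡⟨ *-identityˡ T ⟩
      T ∎
      where
      I : Carrier
      I = (1# + Nrm) ⁻¹

  case₂ : Bijective _≡_ _≡_ f → B ≡ 0# → A ≢ 0# → ¬ IsCubeInFq A → IsCompInverse finv₂
  case₂ bijective B≡0 A≢0 A-non-cube with even⊎odd m
  ... | inj₁ (k , m≡2k) = left-inverse⇒IsCompInverse bijective finv₂
          (inverse-candidate-∘-f R₂ (R₂-retraction (proj₂ bijective)))
    where open Even k m≡2k A≢0 B≡0
  ... | inj₂ (k , m≡2k+1) = ⊥-elim (A-non-cube (odd⇒IsCubeInFq k m≡2k+1 InFq-A A≢0))

module Matrix {m' : ℕ} (F : GF-q³ (suc m')) (l : ℕ) (δ : GF-q³.Carrier F) where
  open GF-q³ F
  open Setup F l δ using (_^_)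
  open Field F l δ
  open IsCommutativeRing isCommutativeRing hiding (refl; sym; trans)
  open import Algebra.Solver.Ring.NaturalCoefficients.Default commutativeSemiring

  record M₂ : Set where
    constructor mk
    field
      m₁₁ m₁₂ m₂₁ m₂₂ : Carrier
  open M₂ public

  mk-cong : ∀ {a b c d a′ b′ c′ d′} → a ≡ a′ → b ≡ b′ → c ≡ c′ → d ≡ d′ → mk a b c d ≡ mk a′ b′ c′ d′
  mk-cong refl refl refl refl = refl

  infixl 7 _⊗_
  _⊗_ : M₂ → M₂ → M₂
  X ⊗ Y = mk (m₁₁ X * m₁₁ Y + m₁₂ X * m₂₁ Y) (m₁₁ X * m₁₂ Y + m₁₂ X * m₂₂ Y)
             (m₂₁ X * m₁₁ Y + m₂₂ X * m₂₁ Y) (m₂₁ X * m₁₂ Y + m₂₂ X * m₂₂ Y)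

  I₂ : M₂
  I₂ = mk 1# 0# 0# 1#

  ⊗-assoc : ∀ X Y Z → (X ⊗ Y) ⊗ Z ≡ X ⊗ (Y ⊗ Z)
  ⊗-assoc (mk a₁ b₁ c₁ d₁) (mk a₂ b₂ c₂ d₂) (mk a₃ b₃ c₃ d₃) =
    mk-cong (entry a₁ b₁ a₃ c₃) (entry a₁ b₁ b₃ d₃) (entry c₁ d₁ a₃ c₃) (entry c₁ d₁ b₃ d₃)
    where
    entry : ∀ x y z w → (x * a₂ + y * c₂) * z + (x * b₂ + y * d₂) * w ≡ x * (a₂ * z + b₂ * w) + y * (c₂ * z + d₂ * w)
    entry x y z w = solve 8 (λ x y z w a₂ b₂ c₂ d₂ → (x :* a₂ :+ y :* c₂) :* z :+ (x :* b₂ :+ y :* d₂) :* w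
                                                    := x :* (a₂ :* z :+ b₂ :* w) :+ y :* (c₂ :* z :+ d₂ :* w))
                      refl x y z w a₂ b₂ c₂ d₂

  ⊗-identityˡ : ∀ X → I₂ ⊗ X ≡ X
  ⊗-identityˡ (mk a b c d) = mk-cong (entry a c) (entry b d) (entry′ a c) (entry′ b d)
    where
    entry : ∀ x y → 1# * x + 0# * y ≡ x
    entry x y = solve 2 (λ x y → con 1 :* x :+ con 0 :* y := x) refl x y
    entry′ : ∀ x y → 0# * x + 1# * y ≡ y
    entry′ x y = solve 2 (λ x y → con 0 :* x :+ con 1 :* y := y) refl x y

  ⊗-identityʳ : ∀ X → X ⊗ I₂ ≡ X
  ⊗-identityʳ (mk a b c d) = mk-cong (entry a b) (entry′ a b) (entry c d) (entry′ c d)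
    where
    entry : ∀ x y → x * 1# + y * 0# ≡ x
    entry x y = solve 2 (λ x y → x :* con 1 :+ y :* con 0 := x) refl x y
    entry′ : ∀ x y → x * 0# + y * 1# ≡ y
    entry′ x y = solve 2 (λ x y → x :* con 0 :+ y :* con 1 := y) refl x y

  -- In characteristic 2, det X = m₁₁ m₂₂ - m₁₂ m₂₁ = m₁₁ m₂₂ + m₁₂ m₂₁.
  det : M₂ → Carrier
  det X = m₁₁ X * m₂₂ X + m₁₂ X * m₂₁ X

  det-⊗ : ∀ X Y → det (X ⊗ Y) ≡ det X * det Y
  det-⊗ (mk a₁ b₁ c₁ d₁) (mk a₂ b₂ c₂ d₂) = cancel-double (b₁ * d₁ * c₂ * d₂ + a₁ * c₁ * a₂ * b₂)
    (solve 8 (λ a₁ b₁ c₁ d₁ a₂ b₂ c₂ d₂ →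
       (a₁ :* a₂ :+ b₁ :* c₂) :* (c₁ :* b₂ :+ d₁ :* d₂) :+ (a₁ :* b₂ :+ b₁ :* d₂) :* (c₁ :* a₂ :+ d₁ :* c₂)
       := (a₁ :* d₁ :+ b₁ :* c₁) :* (a₂ :* d₂ :+ b₂ :* c₂)
          :+ ((b₁ :* d₁ :* c₂ :* d₂ :+ a₁ :* c₁ :* a₂ :* b₂) :+ (b₁ :* d₁ :* c₂ :* d₂ :+ a₁ :* c₁ :* a₂ :* b₂)))
       refl a₁ b₁ c₁ d₁ a₂ b₂ c₂ d₂)

  tr : M₂ → Carrier
  tr X = m₁₁ X + m₂₂ X

  tr-⊗-comm : ∀ X Y → tr (X ⊗ Y) ≡ tr (Y ⊗ X)
  tr-⊗-comm (mk a₁ b₁ c₁ d₁) (mk a₂ b₂ c₂ d₂) =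
    solve 8 (λ a₁ b₁ c₁ d₁ a₂ b₂ c₂ d₂ → (a₁ :* a₂ :+ b₁ :* c₂) :+ (c₁ :* b₂ :+ d₁ :* d₂)
                                         := (a₂ :* a₁ :+ b₂ :* c₁) :+ (c₂ :* b₁ :+ d₂ :* d₁))
      refl a₁ b₁ c₁ d₁ a₂ b₂ c₂ d₂

  square-entries : M₂ → M₂
  square-entries X = mk (m₁₁ X ^ 2) (m₁₂ X ^ 2) (m₂₁ X ^ 2) (m₂₂ X ^ 2)

  square-entries-⊗ : ∀ X Y → square-entries (X ⊗ Y) ≡ square-entries X ⊗ square-entries Y
  square-entries-⊗ X Y =
    mk-cong (entry (m₁₁ X) (m₁₁ Y) (m₁₂ X) (m₂₁ Y)) (entry (m₁₁ X) (m₁₂ Y) (m₁₂ X) (m₂₂ Y))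
            (entry (m₂₁ X) (m₁₁ Y) (m₂₂ X) (m₂₁ Y)) (entry (m₂₁ X) (m₁₂ Y) (m₂₂ X) (m₂₂ Y))
    where
    entry : ∀ a b c d → (a * b + c * d) ^ 2 ≡ a ^ 2 * b ^ 2 + c ^ 2 * d ^ 2
    entry a b c d = trans ([x+y]²≡x²+y² _ _) (cong₂ _+_ (^-distribʳ-* a b 2) (^-distribʳ-* c d 2))

  tr-square-entries : ∀ X → tr (square-entries X) ≡ tr X ^ 2
  tr-square-entries X = sym ([x+y]²≡x²+y² _ _)

module Case₃ {m' : ℕ} (F : GF-q³ (suc m')) (l : ℕ) (δ : GF-q³.Carrier F) where
  open GF-q³ F
  open Setup F l δ
  open Field F l δ
  open Subfield F l δ
  open Reduction F l δ
  open Inversion F l δ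
  open Linearised F l δ
  open Matrix F l δ
  open IsCommutativeRing isCommutativeRing hiding (refl; sym; trans)
  open import Algebra.Solver.Ring.NaturalCoefficients.Default commutativeSemiring
  open ≡-Reasoning

  -- the companion matrix of Λ-recurrence for (T ^ 2 ^ (j + 1), T ^ 2 ^ j)
  K : ℕ → M₂
  K j = mk (B ^ (2 ℕ.^ j)) (A ^ (2 ℕ.^ j)) 1# 0#

  K-product : ℕ → ℕ → M₂
  K-product s zero = I₂
  K-product s (suc n) = K (s ℕ.+ n) ⊗ K-product s n

  K-product-+ : ∀ s a b → K-product s (a ℕ.+ b) ≡ K-product (s ℕ.+ b) a ⊗ K-product s b
  K-product-+ s zero b = sym (⊗-identityˡ _)
  K-product-+ s (suc a) b = begin
    K (s ℕ.+ (a ℕ.+ b)) ⊗ K-product s (a ℕ.+ b)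
      ≡⟨ cong₂ _⊗_ (cong K (trans (cong (s ℕ.+_) (ℕP.+-comm a b)) (sym (ℕP.+-assoc s b a))))
           (K-product-+ s a b) ⟩
    K (s ℕ.+ b ℕ.+ a) ⊗ (K-product (s ℕ.+ b) a ⊗ K-product s b)
      ≡⟨ sym (⊗-assoc _ _ _) ⟩
    K (s ℕ.+ b ℕ.+ a) ⊗ K-product (s ℕ.+ b) a ⊗ K-product s b ∎

  ^2^-twist : ∀ x k s → (x ^ (2 ℕ.^ k)) ^ (2 ℕ.^ s) ≡ x ^ (2 ℕ.^ (s ℕ.+ k))
  ^2^-twist x k s = trans (^-^-2^ x k s) (cong (λ w → x ^ (2 ℕ.^ w)) (ℕP.+-comm k s))

  square-entries-K-product : ∀ s n → square-entries (K-product s n) ≡ K-product (suc s) n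
  square-entries-K-product s zero = mk-cong (1^n≡1 2) (zeroˡ _) (zeroˡ _) (1^n≡1 2)
  square-entries-K-product s (suc n) = trans (square-entries-⊗ (K (s ℕ.+ n)) (K-product s n))
    (cong₂ _⊗_ (mk-cong (^2^-twist B (s ℕ.+ n) 1) (^2^-twist A (s ℕ.+ n) 1) (1^n≡1 2) (zeroˡ _))
               (square-entries-K-product s n))

  det-K-product : ∀ s n → det (K-product s n) * A ^ (2 ℕ.^ s) ≡ A ^ (2 ℕ.^ (s ℕ.+ n))
  det-K-product s zero = trans (cong (_* A ^ (2 ℕ.^ s)) (solve 0 (con 1 :* con 1 :+ con 0 :* con 0 := con 1) refl))
                               (trans (*-identityˡ _) (cong (λ w → A ^ (2 ℕ.^ w)) (sym (ℕP.+-identityʳ s))))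
  det-K-product s (suc n) = begin
    det (K (s ℕ.+ n) ⊗ K-product s n) * A ^ (2 ℕ.^ s)
      ≡⟨ cong (_* A ^ (2 ℕ.^ s)) (det-⊗ (K (s ℕ.+ n)) (K-product s n)) ⟩
    det (K (s ℕ.+ n)) * det (K-product s n) * A ^ (2 ℕ.^ s)
      ≡⟨ *-assoc _ _ _ ⟩
    det (K (s ℕ.+ n)) * (det (K-product s n) * A ^ (2 ℕ.^ s))
      ≡⟨ cong₂ _*_ det-K (det-K-product s n) ⟩
    A ^ (2 ℕ.^ (s ℕ.+ n)) * A ^ (2 ℕ.^ (s ℕ.+ n))
      ≡⟨ sym (^-distribˡ-+-* A (2 ℕ.^ (s ℕ.+ n)) (2 ℕ.^ (s ℕ.+ n))) ⟩
    A ^ (2 ℕ.^ (s ℕ.+ n) ℕ.+ 2 ℕ.^ (s ℕ.+ n))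
      ≡⟨ cong (λ w → A ^ (2 ℕ.^ (s ℕ.+ n) ℕ.+ w)) (sym (ℕP.+-identityʳ _)) ⟩
    A ^ (2 ℕ.^ suc (s ℕ.+ n))
      ≡⟨ cong (λ w → A ^ (2 ℕ.^ w)) (sym (ℕP.+-suc s n)) ⟩
    A ^ (2 ℕ.^ (s ℕ.+ suc n)) ∎
    where
    det-K : det (K (s ℕ.+ n)) ≡ A ^ (2 ℕ.^ (s ℕ.+ n))
    det-K = solve 2 (λ b a → b :* con 0 :+ a :* con 1 := a) refl (B ^ (2 ℕ.^ (s ℕ.+ n))) (A ^ (2 ℕ.^ (s ℕ.+ n)))

  Sh-twisted-recurrence : ∀ s k → Sh (suc (suc k)) ^ (2 ℕ.^ s)
                          ≡ B ^ (2 ℕ.^ (s ℕ.+ k)) * Sh (suc k) ^ (2 ℕ.^ s) + A ^ (2 ℕ.^ (s ℕ.+ k)) * Sh k ^ (2 ℕ.^ s)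
  Sh-twisted-recurrence s k = begin
    (B ^ (2 ℕ.^ k) * Sh (suc k) + A ^ (2 ℕ.^ k) * Sh k) ^ (2 ℕ.^ s)
      ≡⟨ trans (frobenius s _ _) (cong₂ _+_ (^-distribʳ-* _ _ (2 ℕ.^ s)) (^-distribʳ-* _ _ (2 ℕ.^ s))) ⟩
    (B ^ (2 ℕ.^ k)) ^ (2 ℕ.^ s) * Sh (suc k) ^ (2 ℕ.^ s) + (A ^ (2 ℕ.^ k)) ^ (2 ℕ.^ s) * Sh k ^ (2 ℕ.^ s)
      ≡⟨ cong₂ (λ b a → b * Sh (suc k) ^ (2 ℕ.^ s) + a * Sh k ^ (2 ℕ.^ s)) (^2^-twist B k s) (^2^-twist A k s) ⟩
    B ^ (2 ℕ.^ (s ℕ.+ k)) * Sh (suc k) ^ (2 ℕ.^ s) + A ^ (2 ℕ.^ (s ℕ.+ k)) * Sh k ^ (2 ℕ.^ s) ∎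

  K-product-column : ∀ s n → m₁₁ (K-product s n) ≡ Sh (suc n) ^ (2 ℕ.^ s) × m₂₁ (K-product s n) ≡ Sh n ^ (2 ℕ.^ s)
  K-product-column s zero = sym (1^n≡1 (2 ℕ.^ s)) , sym (0^2^k≡0 s)
  K-product-column s (suc n) = first , second
    where
    column : m₁₁ (K-product s n) ≡ Sh (suc n) ^ (2 ℕ.^ s) × m₂₁ (K-product s n) ≡ Sh n ^ (2 ℕ.^ s)
    column = K-product-column s n
    first : m₁₁ (K-product s (suc n)) ≡ Sh (suc (suc n)) ^ (2 ℕ.^ s)
    first = trans (cong₂ (λ x y → B ^ (2 ℕ.^ (s ℕ.+ n)) * x + A ^ (2 ℕ.^ (s ℕ.+ n)) * y) (proj₁ column) (proj₂ column))
                  (sym (Sh-twisted-recurrence s n))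
    second : m₂₁ (K-product s (suc n)) ≡ Sh (suc n) ^ (2 ℕ.^ s)
    second = trans (cong₂ (λ x y → 1# * x + 0# * y) (proj₁ column) (proj₂ column))
                   (solve 2 (λ x y → con 1 :* x :+ con 0 :* y := x) refl (Sh (suc n) ^ (2 ℕ.^ s)) (Sh n ^ (2 ℕ.^ s)))

  [bx+ay]v≡b[xv]+a[yv] : ∀ b x a y v → (b * x + a * y) * v ≡ b * (x * v) + a * (y * v)
  [bx+ay]v≡b[xv]+a[yv] = solve 5 (λ b x a y v → (b :* x :+ a :* y) :* v := b :* (x :* v) :+ a :* (y :* v)) refl

  -- the inhomogeneous part of the unrolled recurrence, see unroll
  w₁ w₂ : Carrier → ℕ → Carrier
  w₁ u n = Σ< n (λ i → Sh (n ℕ.∸ i) ^ (2 ℕ.^ suc i) * u ^ (2 ℕ.^ i))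
  w₂ u n = Σ< n (λ i → Sh (n ℕ.∸ suc i) ^ (2 ℕ.^ suc i) * u ^ (2 ℕ.^ i))

  w₂-suc : ∀ u n → w₂ u (suc n) ≡ w₁ u n
  w₂-suc u n = begin
    w₁ u n + Sh (n ℕ.∸ n) ^ (2 ℕ.^ suc n) * u ^ (2 ℕ.^ n)
      ≡⟨ cong (λ k → w₁ u n + Sh k ^ (2 ℕ.^ suc n) * u ^ (2 ℕ.^ n)) (ℕP.n∸n≡0 n) ⟩
    w₁ u n + 0# ^ (2 ℕ.^ suc n) * u ^ (2 ℕ.^ n)
      ≡⟨ cong (λ z → w₁ u n + z * u ^ (2 ℕ.^ n)) (0^2^k≡0 (suc n)) ⟩
    w₁ u n + 0# * u ^ (2 ℕ.^ n)
      ≡⟨ trans (cong (w₁ u n +_) (zeroˡ _)) (+-identityʳ _) ⟩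
    w₁ u n ∎

  w₁-suc : ∀ u n → w₁ u (suc n) ≡ B ^ (2 ℕ.^ n) * w₁ u n + A ^ (2 ℕ.^ n) * w₂ u n + u ^ (2 ℕ.^ n)
  w₁-suc u n = begin
    Σ< n (λ i → Sh (suc n ℕ.∸ i) ^ (2 ℕ.^ suc i) * u ^ (2 ℕ.^ i)) + Sh (suc n ℕ.∸ n) ^ (2 ℕ.^ suc n) * u ^ (2 ℕ.^ n)
      ≡⟨ cong₂ _+_ (Σ<-cong n (λ i i<n → trans (cong (_* u ^ (2 ℕ.^ i)) (coefficient i i<n)) ([bx+ay]v≡b[xv]+a[yv] _ _ _ _ _)))
                   last-term ⟩
    Σ< n (λ i → b * (Sh (n ℕ.∸ i) ^ (2 ℕ.^ suc i) * u ^ (2 ℕ.^ i)) + a * (Sh (n ℕ.∸ suc i) ^ (2 ℕ.^ suc i) * u ^ (2 ℕ.^ i)))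
      + u ^ (2 ℕ.^ n)
      ≡⟨ cong (_+ u ^ (2 ℕ.^ n)) (trans (Σ<-distrib-+ n _ _) (cong₂ _+_ (Σ<-*ˡ n b _) (Σ<-*ˡ n a _))) ⟩
    b * w₁ u n + a * w₂ u n + u ^ (2 ℕ.^ n) ∎
    where
    b a : Carrier
    b = B ^ (2 ℕ.^ n)
    a = A ^ (2 ℕ.^ n)
    last-term : Sh (suc n ℕ.∸ n) ^ (2 ℕ.^ suc n) * u ^ (2 ℕ.^ n) ≡ u ^ (2 ℕ.^ n)
    last-term = trans (cong (λ k → Sh k ^ (2 ℕ.^ suc n) * u ^ (2 ℕ.^ n)) (ℕP.m+n∸n≡m 1 n))
                      (trans (cong (_* u ^ (2 ℕ.^ n)) (1^n≡1 (2 ℕ.^ suc n))) (*-identityˡ _))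
    coefficient : ∀ i → i ℕ.< n → Sh (suc n ℕ.∸ i) ^ (2 ℕ.^ suc i)
                  ≡ b * Sh (n ℕ.∸ i) ^ (2 ℕ.^ suc i) + a * Sh (n ℕ.∸ suc i) ^ (2 ℕ.^ suc i)
    coefficient i i<n = begin
      Sh (suc n ℕ.∸ i) ^ (2 ℕ.^ suc i)
        ≡⟨ cong (λ k → Sh k ^ (2 ℕ.^ suc i)) (trans (ℕP.+-∸-assoc 1 (ℕP.<⇒≤ i<n)) (cong suc n∸i≡1+j)) ⟩
      Sh (suc (suc j)) ^ (2 ℕ.^ suc i)
        ≡⟨ Sh-twisted-recurrence (suc i) j ⟩
      B ^ (2 ℕ.^ (suc i ℕ.+ j)) * Sh (suc j) ^ (2 ℕ.^ suc i) + A ^ (2 ℕ.^ (suc i ℕ.+ j)) * Sh j ^ (2 ℕ.^ suc i)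
        ≡⟨ cong₂ (λ k k′ → B ^ (2 ℕ.^ k) * Sh k′ ^ (2 ℕ.^ suc i) + A ^ (2 ℕ.^ k) * Sh j ^ (2 ℕ.^ suc i))
                 (ℕP.m+[n∸m]≡n i<n) (sym n∸i≡1+j) ⟩
      b * Sh (n ℕ.∸ i) ^ (2 ℕ.^ suc i) + a * Sh j ^ (2 ℕ.^ suc i) ∎
      where
      j : ℕ
      j = n ℕ.∸ suc i
      n∸i≡1+j : n ℕ.∸ i ≡ suc j
      n∸i≡1+j = n<m⇒m∸n≡1+[m∸1+n] i<n

  P : M₂
  P = K-product 0 m

  Δ : Carrier
  Δ = (1# + m₁₁ P) * (1# + m₂₂ P) + m₁₂ P * m₂₁ P

  module Unrolling {T : Carrier} (T∈ : InFq T) where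
    u : Carrier
    u = Λ T

    row₁ row₂ : M₂ → Carrier
    row₁ X = m₁₁ X * T ^ 2 + m₁₂ X * T
    row₂ X = m₂₁ X * T ^ 2 + m₂₂ X * T

    Λ-recurrence : ∀ n → T ^ (2 ℕ.^ suc (suc n))
                   ≡ B ^ (2 ℕ.^ n) * T ^ (2 ℕ.^ suc n) + A ^ (2 ℕ.^ n) * T ^ (2 ℕ.^ n) + u ^ (2 ℕ.^ n)
    Λ-recurrence n = x+y≡z⇒x≡y+z (sym (begin
      (T ^ 4 + B * T ^ 2 + A * T) ^ (2 ℕ.^ n)
        ≡⟨ trans (frobenius n _ _) (cong₂ _+_ (frobenius n _ _) (^-distribʳ-* A T (2 ℕ.^ n))) ⟩
      (T ^ 4) ^ (2 ℕ.^ n) + (B * T ^ 2) ^ (2 ℕ.^ n) + A ^ (2 ℕ.^ n) * T ^ (2 ℕ.^ n)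
        ≡⟨ cong₂ (λ x y → x + y + A ^ (2 ℕ.^ n) * T ^ (2 ℕ.^ n))
                 (^2^-twist T 2 n) (trans (^-distribʳ-* B (T ^ 2) (2 ℕ.^ n)) (cong (B ^ (2 ℕ.^ n) *_) (^2^-twist T 1 n))) ⟩
      T ^ (2 ℕ.^ (n ℕ.+ 2)) + B ^ (2 ℕ.^ n) * T ^ (2 ℕ.^ (n ℕ.+ 1)) + A ^ (2 ℕ.^ n) * T ^ (2 ℕ.^ n)
        ≡⟨ cong₂ (λ k k′ → T ^ (2 ℕ.^ k) + B ^ (2 ℕ.^ n) * T ^ (2 ℕ.^ k′) + A ^ (2 ℕ.^ n) * T ^ (2 ℕ.^ n))
                 (ℕP.+-comm n 2) (ℕP.+-comm n 1) ⟩
      T ^ (2 ℕ.^ suc (suc n)) + B ^ (2 ℕ.^ n) * T ^ (2 ℕ.^ suc n) + A ^ (2 ℕ.^ n) * T ^ (2 ℕ.^ n)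
        ≡⟨ +-assoc _ _ _ ⟩
      T ^ (2 ℕ.^ suc (suc n)) + (B ^ (2 ℕ.^ n) * T ^ (2 ℕ.^ suc n) + A ^ (2 ℕ.^ n) * T ^ (2 ℕ.^ n))
        ∎))

    unroll : ∀ n → T ^ (2 ℕ.^ suc n) ≡ row₁ (K-product 0 n) + w₁ u n
                 × T ^ (2 ℕ.^ n) ≡ row₂ (K-product 0 n) + w₂ u n
    unroll zero = solve 1 (λ T → T :^ 2 := (con 1 :* T :^ 2 :+ con 0 :* T) :+ con 0) refl T
                , solve 1 (λ T → T :^ 1 := (con 0 :* T :^ 2 :+ con 1 :* T) :+ con 0) refl T
    unroll (suc n) = first , second
      where
      X : M₂
      X = K-product 0 n
      b a : Carrier
      b = B ^ (2 ℕ.^ n)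
      a = A ^ (2 ℕ.^ n)
      first : T ^ (2 ℕ.^ suc (suc n)) ≡ row₁ (K n ⊗ X) + w₁ u (suc n)
      first = begin
        T ^ (2 ℕ.^ suc (suc n))
          ≡⟨ Λ-recurrence n ⟩
        b * T ^ (2 ℕ.^ suc n) + a * T ^ (2 ℕ.^ n) + u ^ (2 ℕ.^ n)
          ≡⟨ cong₂ (λ x y → b * x + a * y + u ^ (2 ℕ.^ n)) (proj₁ (unroll n)) (proj₂ (unroll n)) ⟩
        b * (row₁ X + w₁ u n) + a * (row₂ X + w₂ u n) + u ^ (2 ℕ.^ n)
          ≡⟨ solve 11 (λ b a x₁₁ x₁₂ x₂₁ x₂₂ T² T w₁ w₂ v →
                 b :* (x₁₁ :* T² :+ x₁₂ :* T :+ w₁) :+ a :* (x₂₁ :* T² :+ x₂₂ :* T :+ w₂) :+ v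
                 := (b :* x₁₁ :+ a :* x₂₁) :* T² :+ (b :* x₁₂ :+ a :* x₂₂) :* T :+ (b :* w₁ :+ a :* w₂ :+ v))
               refl b a (m₁₁ X) (m₁₂ X) (m₂₁ X) (m₂₂ X) (T ^ 2) T (w₁ u n) (w₂ u n) (u ^ (2 ℕ.^ n)) ⟩
        row₁ (K n ⊗ X) + (b * w₁ u n + a * w₂ u n + u ^ (2 ℕ.^ n))
          ≡⟨ cong (row₁ (K n ⊗ X) +_) (sym (w₁-suc u n)) ⟩
        row₁ (K n ⊗ X) + w₁ u (suc n) ∎
      second : T ^ (2 ℕ.^ suc n) ≡ row₂ (K n ⊗ X) + w₂ u (suc n)
      second = begin
        T ^ (2 ℕ.^ suc n)
          ≡⟨ proj₁ (unroll n) ⟩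
        row₁ X + w₁ u n
          ≡⟨ solve 7 (λ x₁₁ x₁₂ x₂₁ x₂₂ T² T w → x₁₁ :* T² :+ x₁₂ :* T :+ w
               := (con 1 :* x₁₁ :+ con 0 :* x₂₁) :* T² :+ (con 1 :* x₁₂ :+ con 0 :* x₂₂) :* T :+ w)
               refl (m₁₁ X) (m₁₂ X) (m₂₁ X) (m₂₂ X) (T ^ 2) T (w₁ u n) ⟩
        row₂ (K n ⊗ X) + w₁ u n
          ≡⟨ cong (row₂ (K n ⊗ X) +_) (sym (w₂-suc u n)) ⟩
        row₂ (K n ⊗ X) + w₂ u (suc n) ∎

    w₁[m]≡ : w₁ u m ≡ (1# + m₁₁ P) * T ^ 2 + m₁₂ P * T
    w₁[m]≡ = begin
      w₁ u m
        ≡⟨ x+y≡z⇒x≡y+z (trans (+-comm _ _) (sym (proj₁ (unroll m)))) ⟩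
      row₁ P + T ^ (2 ℕ.^ suc m)
        ≡⟨ cong (row₁ P +_) T^[2q]≡T² ⟩
      m₁₁ P * T ^ 2 + m₁₂ P * T + T ^ 2
        ≡⟨ solve 4 (λ p r T² T → p :* T² :+ r :* T :+ T² := (con 1 :+ p) :* T² :+ r :* T) refl (m₁₁ P) (m₁₂ P) (T ^ 2) T ⟩
      (1# + m₁₁ P) * T ^ 2 + m₁₂ P * T ∎
      where
      T^[2q]≡T² : T ^ (2 ℕ.* q) ≡ T ^ 2
      T^[2q]≡T² = trans (sym (^-*-assoc T 2 q)) (trans (^-^-comm T 2 q) (cong (_^ 2) T∈))

    w₂[m]≡ : w₂ u m ≡ m₂₁ P * T ^ 2 + (1# + m₂₂ P) * T
    w₂[m]≡ = begin
      w₂ u m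
        ≡⟨ x+y≡z⇒x≡y+z (trans (+-comm _ _) (sym (proj₂ (unroll m)))) ⟩
      row₂ P + T ^ q
        ≡⟨ cong (row₂ P +_) T∈ ⟩
      m₂₁ P * T ^ 2 + m₂₂ P * T + T
        ≡⟨ solve 4 (λ s t T² T → s :* T² :+ t :* T :+ T := s :* T² :+ (con 1 :+ t) :* T) refl (m₂₁ P) (m₂₂ P) (T ^ 2) T ⟩
      m₂₁ P * T ^ 2 + (1# + m₂₂ P) * T ∎

    adjugate-row₁ : (1# + m₂₂ P) * w₁ u m + m₁₂ P * w₂ u m ≡ Δ * T ^ 2
    adjugate-row₁ = trans (cong₂ (λ x y → (1# + m₂₂ P) * x + m₁₂ P * y) w₁[m]≡ w₂[m]≡)
      (cancel-double ((1# + m₂₂ P) * m₁₂ P * T)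
        (solve 6 (λ p r s t T² T → (con 1 :+ t) :* ((con 1 :+ p) :* T² :+ r :* T) :+ r :* (s :* T² :+ (con 1 :+ t) :* T)
                                   := ((con 1 :+ p) :* (con 1 :+ t) :+ r :* s) :* T² :+ ((con 1 :+ t) :* r :* T :+ (con 1 :+ t) :* r :* T))
          refl (m₁₁ P) (m₁₂ P) (m₂₁ P) (m₂₂ P) (T ^ 2) T))

    adjugate-row₂ : m₂₁ P * w₁ u m + (1# + m₁₁ P) * w₂ u m ≡ Δ * T
    adjugate-row₂ = trans (cong₂ (λ x y → m₂₁ P * x + (1# + m₁₁ P) * y) w₁[m]≡ w₂[m]≡)
      (cancel-double (m₂₁ P * (1# + m₁₁ P) * T ^ 2)
        (solve 6 (λ p r s t T² T → s :* ((con 1 :+ p) :* T² :+ r :* T) :+ (con 1 :+ p) :* (s :* T² :+ (con 1 :+ t) :* T)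
                                   := ((con 1 :+ p) :* (con 1 :+ t) :+ r :* s) :* T :+ (s :* (con 1 :+ p) :* T² :+ s :* (con 1 :+ p) :* T²))
          refl (m₁₁ P) (m₁₂ P) (m₂₁ P) (m₂₂ P) (T ^ 2) T))

  pair-sum : ∀ a b u n → a * w₁ u n + b * w₂ u n
             ≡ Σ< n (λ i → (a * Sh (n ℕ.∸ i) ^ (2 ℕ.^ suc i) + b * Sh (n ℕ.∸ suc i) ^ (2 ℕ.^ suc i)) * u ^ (2 ℕ.^ i))
  pair-sum a b u n = sym (trans (Σ<-cong n (λ i _ → [bx+ay]v≡b[xv]+a[yv] _ _ _ _ _))
                                (trans (Σ<-distrib-+ n _ _) (cong₂ _+_ (Σ<-*ˡ n a _) (Σ<-*ˡ n b _))))

  -- M x = R₃ (Tr x + D), so finv₃ = inverse-candidate R₃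
  R₃ : Carrier → Carrier
  R₃ u = Σ< m (λ i → (Sh (m ℕ.∸ 1 ℕ.∸ i) ^ (2 ℕ.^ suc i) + (A ⁻¹) ^ (2 ℕ.^ suc i ℕ.∸ 1) * S i) * u ^ (2 ℕ.^ i))

  P≡tail⊗head : ∀ {i} → i ℕ.< m → P ≡ K-product (suc i) (m ℕ.∸ suc i) ⊗ K-product 0 (suc i)
  P≡tail⊗head {i} i<m = trans (cong (K-product 0) (sym (ℕP.m∸n+n≡m i<m))) (K-product-+ 0 (m ℕ.∸ suc i) (suc i))

  det-tail : A ≢ 0# → ∀ {i} → i ℕ.< m → det (K-product (suc i) (m ℕ.∸ suc i)) ≡ (A ⁻¹) ^ (2 ℕ.^ suc i ℕ.∸ 1)
  det-tail A≢0 {i} i<m = *-cancelˡ (x^n≢0 (2 ℕ.^ suc i) A≢0) (begin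
    A ^ (2 ℕ.^ suc i) * det X
      ≡⟨ *-comm _ _ ⟩
    det X * A ^ (2 ℕ.^ suc i)
      ≡⟨ det-K-product (suc i) (m ℕ.∸ suc i) ⟩
    A ^ (2 ℕ.^ (suc i ℕ.+ (m ℕ.∸ suc i)))
      ≡⟨ cong (λ n → A ^ (2 ℕ.^ n)) (ℕP.m+[n∸m]≡n i<m) ⟩
    A ^ q
      ≡⟨ InFq-A ⟩
    A
      ≡⟨ sym (trans (*-assoc _ _ _) (trans (cong (A *_) (x^n*x⁻¹^n≡1 A≢0 k)) (*-identityʳ A))) ⟩
    A * A ^ k * (A ⁻¹) ^ k
      ≡⟨ cong (λ n → A ^ n * (A ⁻¹) ^ k) (ℕP.m+[n∸m]≡n (ℕP.m^n>0 2 (suc i))) ⟩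
    A ^ (2 ℕ.^ suc i) * (A ⁻¹) ^ k ∎)
    where
    k : ℕ
    k = 2 ℕ.^ suc i ℕ.∸ 1
    X : M₂
    X = K-product (suc i) (m ℕ.∸ suc i)

  -- With P = X ⊗ Y as in P≡tail⊗head, the coefficient of M is m₂₁ X + det X * m₂₁ Y.
  M-coefficient : A ≢ 0# → ∀ i → i ℕ.< m →
    Sh (m ℕ.∸ 1 ℕ.∸ i) ^ (2 ℕ.^ suc i) + (A ⁻¹) ^ (2 ℕ.^ suc i ℕ.∸ 1) * S i
    ≡ m₂₁ P * Sh (m ℕ.∸ i) ^ (2 ℕ.^ suc i) + (1# + m₁₁ P) * Sh (m ℕ.∸ suc i) ^ (2 ℕ.^ suc i)
  M-coefficient A≢0 i i<m = begin
    Sh (m ℕ.∸ 1 ℕ.∸ i) ^ (2 ℕ.^ suc i) + (A ⁻¹) ^ (2 ℕ.^ suc i ℕ.∸ 1) * S i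
      ≡⟨ cong₂ _+_ (trans (cong (λ n → Sh n ^ (2 ℕ.^ suc i)) (ℕP.∸-+-assoc m 1 i)) (sym X₂₁≡))
                   (cong₂ _*_ (sym (det-tail A≢0 i<m)) (sym Y₂₁≡)) ⟩
    m₂₁ X + det X * m₂₁ Y
      ≡⟨ sym (cancel-double (m₁₁ X * m₂₁ X * m₁₁ Y)
           (solve 6 (λ x₁₁ x₁₂ x₂₁ x₂₂ y₁₁ y₂₁ →
              (x₂₁ :* y₁₁ :+ x₂₂ :* y₂₁) :* x₁₁ :+ (con 1 :+ (x₁₁ :* y₁₁ :+ x₁₂ :* y₂₁)) :* x₂₁
              := x₂₁ :+ (x₁₁ :* x₂₂ :+ x₁₂ :* x₂₁) :* y₂₁ :+ (x₁₁ :* x₂₁ :* y₁₁ :+ x₁₁ :* x₂₁ :* y₁₁))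
            refl (m₁₁ X) (m₁₂ X) (m₂₁ X) (m₂₂ X) (m₁₁ Y) (m₂₁ Y))) ⟩
    m₂₁ (X ⊗ Y) * m₁₁ X + (1# + m₁₁ (X ⊗ Y)) * m₂₁ X
      ≡⟨ cong₂ (λ Z x → m₂₁ Z * x + (1# + m₁₁ Z) * m₂₁ X) (sym (P≡tail⊗head i<m)) X₁₁≡ ⟩
    m₂₁ P * Sh (m ℕ.∸ i) ^ (2 ℕ.^ suc i) + (1# + m₁₁ P) * m₂₁ X
      ≡⟨ cong (λ x → m₂₁ P * Sh (m ℕ.∸ i) ^ (2 ℕ.^ suc i) + (1# + m₁₁ P) * x) X₂₁≡ ⟩
    m₂₁ P * Sh (m ℕ.∸ i) ^ (2 ℕ.^ suc i) + (1# + m₁₁ P) * Sh (m ℕ.∸ suc i) ^ (2 ℕ.^ suc i) ∎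
    where
    X Y : M₂
    X = K-product (suc i) (m ℕ.∸ suc i)
    Y = K-product 0 (suc i)
    X₁₁≡ : m₁₁ X ≡ Sh (m ℕ.∸ i) ^ (2 ℕ.^ suc i)
    X₁₁≡ = trans (proj₁ (K-product-column (suc i) (m ℕ.∸ suc i)))
                 (cong (λ n → Sh n ^ (2 ℕ.^ suc i)) (sym (n<m⇒m∸n≡1+[m∸1+n] i<m)))
    X₂₁≡ : m₂₁ X ≡ Sh (m ℕ.∸ suc i) ^ (2 ℕ.^ suc i)
    X₂₁≡ = proj₂ (K-product-column (suc i) (m ℕ.∸ suc i))
    Y₂₁≡ : m₂₁ Y ≡ S i
    Y₂₁≡ = trans (proj₂ (K-product-column 0 (suc i))) (^-identityʳ _)

  R₃∘Λ : A ≢ 0# → ∀ T → InFq T → R₃ (Λ T) ≡ Δ * T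
  R₃∘Λ A≢0 T T∈ = begin
    R₃ (Λ T)
      ≡⟨ Σ<-cong m (λ i i<m → cong (_* Λ T ^ (2 ℕ.^ i)) (M-coefficient A≢0 i i<m)) ⟩
    Σ< m (λ i → (m₂₁ P * Sh (m ℕ.∸ i) ^ (2 ℕ.^ suc i) + (1# + m₁₁ P) * Sh (m ℕ.∸ suc i) ^ (2 ℕ.^ suc i)) * Λ T ^ (2 ℕ.^ i))
      ≡⟨ sym (pair-sum (m₂₁ P) (1# + m₁₁ P) (Λ T) m) ⟩
    m₂₁ P * w₁ (Λ T) m + (1# + m₁₁ P) * w₂ (Λ T) m
      ≡⟨ Unrolling.adjugate-row₂ T∈ ⟩
    Δ * T ∎

  det-P≡1 : A ≢ 0# → det P ≡ 1#
  det-P≡1 A≢0 = *-cancelˡ A≢0 (begin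
    A * det P     ≡⟨ *-comm _ _ ⟩
    det P * A     ≡⟨ cong (det P *_) (sym (^-identityʳ A)) ⟩
    det P * A ^ 1 ≡⟨ det-K-product 0 m ⟩
    A ^ q         ≡⟨ InFq-A ⟩
    A             ≡⟨ sym (*-identityʳ A) ⟩
    A * 1#        ∎)

  Δ≡tr-P : A ≢ 0# → Δ ≡ tr P
  Δ≡tr-P A≢0 = begin
    (1# + p) * (1# + t) + r * s
      ≡⟨ solve 4 (λ p r s t → (con 1 :+ p) :* (con 1 :+ t) :+ r :* s := p :+ t :+ (con 1 :+ (p :* t :+ r :* s))) refl p r s t ⟩
    p + t + (1# + det P)
      ≡⟨ cong (λ x → p + t + (1# + x)) (det-P≡1 A≢0) ⟩
    p + t + (1# + 1#)
      ≡⟨ cancel-double 1# refl ⟩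
    tr P ∎
    where
    p r s t : Carrier
    p = m₁₁ P
    r = m₁₂ P
    s = m₂₁ P
    t = m₂₂ P

  -- Squaring shifts the factors of P cyclically, since K m = K 0.
  tr-P²≡tr-P : tr P ^ 2 ≡ tr P
  tr-P²≡tr-P = begin
    tr P ^ 2                                   ≡⟨ sym (tr-square-entries P) ⟩
    tr (square-entries P)                      ≡⟨ cong tr (square-entries-K-product 0 m) ⟩
    tr (K m ⊗ K-product 1 m')                  ≡⟨ cong (λ X → tr (X ⊗ K-product 1 m')) K-m≡K-0 ⟩
    tr (K 0 ⊗ K-product 1 m')                  ≡⟨ tr-⊗-comm (K 0) (K-product 1 m') ⟩
    tr (K-product 1 m' ⊗ K 0)                  ≡⟨ cong (λ X → tr (K-product 1 m' ⊗ X)) (sym (⊗-identityʳ (K 0))) ⟩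
    tr (K-product 1 m' ⊗ K-product 0 1)        ≡⟨ cong tr (sym (K-product-+ 0 m' 1)) ⟩
    tr (K-product 0 (m' ℕ.+ 1))                ≡⟨ cong (λ n → tr (K-product 0 n)) (ℕP.+-comm m' 1) ⟩
    tr P                                       ∎
    where
    K-m≡K-0 : K m ≡ K 0
    K-m≡K-0 = mk-cong (trans InFq-B (sym (^-identityʳ B))) (trans InFq-A (sym (^-identityʳ A))) refl refl

  -- for m ≥ 2, read off the coefficients of u ^ 2 ^ (m - 1) and u ^ 2 ^ (m - 2)
  vanishing-pair⇒zero : Surjective _≡_ _≡_ f → ∀ {k} → m' ≡ suc k → ∀ a b →
                        (∀ T → InFq T → a * w₁ (Λ T) m + b * w₂ (Λ T) m ≡ 0#) → a ≡ 0# × b ≡ 0#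
  vanishing-pair⇒zero surjective {k} m'≡1+k a b pair≡0 = a≡0 , b≡0
    where
    c : ℕ → Carrier
    c i = a * Sh (m ℕ.∸ i) ^ (2 ℕ.^ suc i) + b * Sh (m ℕ.∸ suc i) ^ (2 ℕ.^ suc i)
    c≡0 : ∀ i → i ℕ.< m → c i ≡ 0#
    c≡0 = linearised-coefficients-vanish m c (λ i → i) (λ _ i<m → i<m) (λ _ _ i≡j → i≡j) λ u u∈ →
      let (T , T∈ , ΛT≡u) = Λ-surjective surjective u u∈
      in trans (sym (pair-sum a b u m)) (trans (cong (λ v → a * w₁ v m + b * w₂ v m) (sym ΛT≡u)) (pair≡0 T T∈))
    a≡0 : a ≡ 0#
    a≡0 = trans (sym (begin
      c m'
        ≡⟨ cong₂ (λ x y → a * Sh x ^ (2 ℕ.^ m) + b * Sh y ^ (2 ℕ.^ m)) (ℕP.m+n∸n≡m 1 m') (ℕP.n∸n≡0 m') ⟩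
      a * 1# ^ (2 ℕ.^ m) + b * 0# ^ (2 ℕ.^ m)
        ≡⟨ cong₂ (λ x y → a * x + b * y) (1^n≡1 (2 ℕ.^ m)) (0^2^k≡0 m) ⟩
      a * 1# + b * 0#
        ≡⟨ solve 2 (λ a b → a :* con 1 :+ b :* con 0 := a) refl a b ⟩
      a ∎)) (c≡0 m' ℕP.≤-refl)
    b≡0 : b ≡ 0#
    b≡0 = trans (sym (begin
      c k
        ≡⟨ cong₂ (λ x y → x * s + b * Sh y ^ (2 ℕ.^ suc k)) a≡0 m∸[1+k]≡1 ⟩
      0# * s + b * 1# ^ (2 ℕ.^ suc k)
        ≡⟨ cong (λ x → 0# * s + b * x) (1^n≡1 (2 ℕ.^ suc k)) ⟩
      0# * s + b * 1#
        ≡⟨ solve 2 (λ s b → con 0 :* s :+ b :* con 1 := b) refl s b ⟩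
      b ∎)) (c≡0 k k<m)
      where
      s : Carrier
      s = Sh (m ℕ.∸ k) ^ (2 ℕ.^ suc k)
      m∸[1+k]≡1 : m ℕ.∸ suc k ≡ 1
      m∸[1+k]≡1 = trans (cong (ℕ._∸ k) m'≡1+k) (ℕP.m+n∸n≡m 1 k)
      k<m : k ℕ.< m
      k<m = subst (k ℕ.<_) (cong suc (sym m'≡1+k)) (ℕP.m<n⇒m<1+n (ℕP.n<1+n k))

  -- If Δ = 0, both rows of adj (I + P) give vanishing pairs, forcing m₂₁ P = 1 + m₁₁ P =
  -- m₁₂ P = 0, and then w₁ itself vanishes; for m = 1, Δ = tr P = B.
  Δ≢0 : Surjective _≡_ _≡_ f → A ≢ 0# → B ≢ 0# → Δ ≢ 0#
  Δ≢0 surjective A≢0 B≢0 Δ≡0 = by-degree m' refl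
    where
    by-degree : ∀ k → m' ≡ k → ⊥
    by-degree zero m'≡0 = B≢0 (begin
      B
        ≡⟨ solve 2 (λ b a → b := b :* con 1 :* con 1 :+ a :* con 1 :* con 0 :+ (con 1 :* con 0 :+ con 0 :* con 1)) refl B A ⟩
      tr (K-product 0 1)
        ≡⟨ cong (λ n → tr (K-product 0 (suc n))) (sym m'≡0) ⟩
      tr P
        ≡⟨ sym (Δ≡tr-P A≢0) ⟩
      Δ
        ≡⟨ Δ≡0 ⟩
      0# ∎)
    by-degree (suc k) m'≡1+k = 0≢1 (sym (proj₁ (vanishing-pair⇒zero surjective m'≡1+k 1# 0# first-row-vanishes)))
      where
      second-row : m₂₁ P ≡ 0# × 1# + m₁₁ P ≡ 0#
      second-row = vanishing-pair⇒zero surjective m'≡1+k (m₂₁ P) (1# + m₁₁ P)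
        (λ T T∈ → trans (Unrolling.adjugate-row₂ T∈) (trans (cong (_* T) Δ≡0) (zeroˡ T)))
      first-row : 1# + m₂₂ P ≡ 0# × m₁₂ P ≡ 0#
      first-row = vanishing-pair⇒zero surjective m'≡1+k (1# + m₂₂ P) (m₁₂ P)
        (λ T T∈ → trans (Unrolling.adjugate-row₁ T∈) (trans (cong (_* T ^ 2) Δ≡0) (zeroˡ _)))
      first-row-vanishes : ∀ T → InFq T → 1# * w₁ (Λ T) m + 0# * w₂ (Λ T) m ≡ 0#
      first-row-vanishes T T∈ = begin
        1# * w₁ (Λ T) m + 0# * w₂ (Λ T) m
          ≡⟨ solve 2 (λ x y → con 1 :* x :+ con 0 :* y := x) refl (w₁ (Λ T) m) (w₂ (Λ T) m) ⟩
        w₁ (Λ T) m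
          ≡⟨ Unrolling.w₁[m]≡ T∈ ⟩
        (1# + m₁₁ P) * T ^ 2 + m₁₂ P * T
          ≡⟨ cong₂ (λ x y → x * T ^ 2 + y * T) (proj₂ second-row) (proj₂ first-row) ⟩
        0# * T ^ 2 + 0# * T
          ≡⟨ solve 2 (λ x y → con 0 :* x :+ con 0 :* y := con 0) refl (T ^ 2) T ⟩
        0# ∎

  Δ≡1 : Surjective _≡_ _≡_ f → A ≢ 0# → B ≢ 0# → Δ ≡ 1#
  Δ≡1 surjective A≢0 B≢0 = *-cancelˡ (Δ≢0 surjective A≢0 B≢0) (begin
    Δ * Δ         ≡⟨ cong (Δ *_) (sym (*-identityʳ Δ)) ⟩
    Δ ^ 2         ≡⟨ cong (_^ 2) (Δ≡tr-P A≢0) ⟩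
    tr P ^ 2      ≡⟨ tr-P²≡tr-P ⟩
    tr P          ≡⟨ sym (Δ≡tr-P A≢0) ⟩
    Δ             ≡⟨ sym (*-identityʳ Δ) ⟩
    Δ * 1#        ∎)

  case₃ : Bijective _≡_ _≡_ f → A * B ≢ 0# → IsCompInverse finv₃
  case₃ bijective A*B≢0 = left-inverse⇒IsCompInverse bijective finv₃ (inverse-candidate-∘-f R₃ R₃-retraction)
    where
    A≢0 : A ≢ 0#
    A≢0 A≡0 = A*B≢0 (trans (cong (_* B) A≡0) (zeroˡ B))
    B≢0 : B ≢ 0#
    B≢0 B≡0 = A*B≢0 (trans (cong (A *_) B≡0) (zeroʳ A))
    R₃-retraction : ∀ T → InFq T → R₃ (Λ T) ≡ T
    R₃-retraction T T∈ = trans (R₃∘Λ A≢0 T T∈) (trans (cong (_* T) (Δ≡1 (proj₂ bijective) A≢0 B≢0)) (*-identityˡ T))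

theorem3 : (m l : ℕ) → .{{_ : NonZero m}} → (F : GF-q³ m) → (δ : GF-q³.Carrier F) →
    let open GF-q³ F
        open Setup F l δ
    in Bijective _≡_ _≡_ f →
       ((A ≡ 0# → B ≡ 0# → IsCompInverse finv₁)
        × (B ≡ 0# → A ≢ 0# → ¬ IsCubeInFq A → IsCompInverse finv₂)
        × (A * B ≢ 0# → IsCompInverse finv₃))
theorem3 (suc m') l F δ bijective =
  (λ A≡0 B≡0 → Case₁.case₁ F l δ bijective A≡0 B≡0) ,
  (λ B≡0 A≢0 A-non-cube → Case₂.case₂ F l δ bijective B≡0 A≢0 A-non-cube) ,
  (λ A*B≢0 → Case₃.case₃ F l δ bijective A*B≢0)
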